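{- The class of languages of ordered-data trees accepted by ODTA is closed under union and intersection, but not under complementation.
   Context: An ordered-data tree over a finite alphabet $\Sigma$ is a finite unranked ordered tree in which each node $u$ carries a label $\mathrm{lab}_t(u)\in\Sigma$ and a data value $\mathrm{val}_t(u)\in\mathbb{N}$. The profile of a node $u$ is a triple $(l,p,r)\in\{\top,\bot,*\}^3$: $l=\top$ (resp. $\bot$) if $u$ has a left sibling with the same (resp. different) data value, $l=*$ if it has no left sibling; $p$, $r$ likewise for the parent and the right sibling. $\mathrm{Profile}(t)$ is $t$ relabelled over $\Sigma\times\{\top,\bot,*\}^3$ with profiles added. A letter-to-letter tree transducer from $\Sigma$ to $\Gamma$ is an unranked tree automaton (states $Q$, final states $F$, transitions $\delta(q,a)$ regular languages over $Q$ constraining the state-word of the children) with an output relation $\mu\subseteq Q\times\Sigma\times\Gamma$; $t'$ is an output on $t$ if there is an accepting run $\rho$ on $t$ with $(\rho(u),\mathrm{lab}_t(u),\mathrm{lab}_{t'}(u))\in\mu$ at every node; data values are kept. For $t$ over $\Gamma$, $V_t(a)$ is the set of data values of $a$-nodes, $[S]_t=\bigcap_{a\in S}V_t(a)\cap\bigcap_{b\notin S}\overline{V_t(b)}$ for $S\subseteq\Gamma$, and if $d_1<\dots<d_m$ are all data values of $t$, $\mathcal{V}_\Gamma(t)=S_1\cdots S_m$ over $2^\Gamma\setminus\{\emptyset\}$ with $d_i\in[S_i]_t$. An ODTA $\langle\mathcal{T},\mathcal{M},\Gamma_0\rangle$ over $\Sigma$ consists of a letter-to-letter tree transducer $\mathcal{T}$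 from $\Sigma\times\{\top,\bot,*\}^3$ to $\Gamma$, a finite string automaton $\mathcal{M}$ over $2^\Gamma$, and $\Gamma_0\subseteq\Gamma$; it accepts $t$ iff some output $t'$ of $\mathcal{T}$ on $\mathrm{Profile}(t)$ satisfies: $\mathcal{M}$ accepts $\mathcal{V}_\Gamma(t')$ and for every $a\in\Gamma_0$ the $a$-nodes of $t'$ have pairwise distinct data values. The complement of a language is taken within the set of all ordered-data trees over $\Sigma$. -}

module Defs where

open import Data.Nat using (ℕ; _<_)
open import Data.Nat.Properties using () renaming (_≟_ to _≟ℕ_)
open import Data.Fin using (Fin; _≟_)
open import Data.Fin.Subset using (Subset; _∈_)
open import Data.Bool using (Bool; T; if_then_else_)
open import Data.Maybe using (Maybe; just; nothing)
open import Data.Product using (Σ; ∃; _×_; _,_; proj₁; proj₂)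
open import Data.Product.Relation.Binary.Pointwise.NonDependent using ()
open import Data.List using (List; []; _∷_; map; filter)
open import Data.List.Relation.Unary.Any using (any?)
open import Data.List.Relation.Unary.Linked using (Linked)
open import Data.List.Relation.Unary.Unique.Propositional using (Unique)
import Data.List.Membership.Propositional as LMem
open import Data.Vec using (tabulate)
open import Relation.Nullary using (¬_; does)
open import Relation.Nullary.Decidable using (_×-dec_)
open import Relation.Binary.PropositionalEquality using (_≡_)
open import Function.Bundles using (_⇔_)

data Tree (A : Set) : Set where
  node : A → List (Tree A) → Tree A

root : ∀ {A} → Tree A → A
root (node a _) = a

mutual
  nodes : ∀ {A} → Tree A → List A
  nodes (node a ts) = a ∷ nodesF ts

  nodesF : ∀ {A} → List (Tree A) → List A
  nodesF [] = []
  nodesF (t ∷ ts) = appendL (nodes t) (nodesF ts)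

  appendL : ∀ {A} → List A → List A → List A
  appendL [] ys = ys
  appendL (x ∷ xs) ys = x ∷ appendL xs ys

DTree : ℕ → Set
DTree k = Tree (Fin k × ℕ)

-- top = ⊤ (same data value), bot = ⊥ (different), star = * (absent)
data Rel : Set where
  top bot star : Rel

cmp : Maybe ℕ → ℕ → Rel
cmp nothing  d = star
cmp (just e) d = if does (d ≟ℕ e) then top else bot

-- letters of Σ × {⊤,⊥,*}^3 : (label , l , p , r)
PLetter : ℕ → Set
PLetter k = Fin k × Rel × Rel × Rel

rootVal : ∀ {k} → DTree k → ℕ
rootVal t = proj₂ (root t)

nextVal : ∀ {k} → List (DTree k) → Maybe ℕ
nextVal [] = nothing
nextVal (u ∷ _) = just (rootVal u)

mutual
  profileAt : ∀ {k} → Maybe ℕ → Maybe ℕ → Maybe ℕ → DTree k → Tree (PLetter k × ℕ)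
  profileAt p l r (node (a , d) ts) =
    node ((a , cmp l d , cmp p d , cmp r d) , d) (profileF (just d) nothing ts)

  -- arguments: parent value, value of left sibling of the first tree
  profileF : ∀ {k} → Maybe ℕ → Maybe ℕ → List (DTree k) → List (Tree (PLetter k × ℕ))
  profileF p l [] = []
  profileF p l (t ∷ ts) = profileAt p l (nextVal ts) t ∷ profileF p (just (rootVal t)) ts

Profile : ∀ {k} → DTree k → Tree (PLetter k × ℕ)
Profile t = profileAt nothing nothing nothing t

record NFA (A : Set) : Set where
  field
    nst    : ℕ
    start  : Fin nst → Bool
    accept : Fin nst → Bool
    step   : Fin nst → A → Fin nst → Bool

module _ {A : Set} (M : NFA A) where
  open NFA M
  data Reach : Fin nst → List A → Set where
    done : ∀ {s} → T (accept s) → Reach s []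
    next : ∀ {s s' a w} → T (step s a s') → Reach s' w → Reach s (a ∷ w)

  NFAAccepts : List A → Set
  NFAAccepts w = ∃ λ s → T (start s) × Reach s w

record Transducer (k m : ℕ) : Set where
  field
    nQ    : ℕ
    final : Fin nQ → Bool
    δ     : Fin nQ → PLetter k → NFA (Fin nQ)
    μ     : Fin nQ → PLetter k → Fin m → Bool

module _ {k m : ℕ} (𝒯 : Transducer k m) where
  open Transducer 𝒯
  mutual
    data Out : Fin nQ → Tree (PLetter k × ℕ) → Tree (Fin m × ℕ) → Set where
      node : ∀ {q a b d ts ts' qs} →
             T (μ q a b) →
             NFAAccepts (δ q a) qs →
             Outs qs ts ts' →
             Out q (node (a , d) ts) (node (b , d) ts')

    data Outs : List (Fin nQ) → List (Tree (PLetter k × ℕ)) → List (Tree (Fin m × ℕ)) → Set where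
      []  : Outs [] [] []
      _∷_ : ∀ {q qs t ts t' ts'} → Out q t t' → Outs qs ts ts' → Outs (q ∷ qs) (t ∷ ts) (t' ∷ ts')

  IsOutput : Tree (PLetter k × ℕ) → Tree (Fin m × ℕ) → Set
  IsOutput t t' = ∃ λ q → T (final q) × Out q t t'

module _ {m : ℕ} where
  -- { a ∈ Γ | d ∈ V_t(a) }, i.e. the S with d ∈ [S]_t
  classOf : Tree (Fin m × ℕ) → ℕ → Subset m
  classOf t d = tabulate λ a →
    does (any? (λ x → (proj₁ x ≟ a) ×-dec (proj₂ x ≟ℕ d)) (nodes t))

  allVals : Tree (Fin m × ℕ) → List ℕ
  allVals t = map proj₂ (nodes t)

  -- w = 𝒱_Γ(t): with d₁ < … < d_n all data values of t, w = S₁ ⋯ S_n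
  IsDataWord : Tree (Fin m × ℕ) → List (Subset m) → Set
  IsDataWord t w = Σ (List ℕ) λ ds →
      Linked _<_ ds
    × (∀ d → (d LMem.∈ ds) ⇔ (d LMem.∈ allVals t))
    × w ≡ map (classOf t) ds

  valsOf : Fin m → Tree (Fin m × ℕ) → List ℕ
  valsOf a t = map proj₂ (filter (λ x → proj₁ x ≟ a) (nodes t))

record ODTA (k : ℕ) : Set where
  field
    m  : ℕ
    𝒯  : Transducer k m
    ℳ  : NFA (Subset m)
    Γ₀ : Subset m

ODTAAccepts : ∀ {k} → ODTA k → DTree k → Set
ODTAAccepts A t = ∃ λ t' →
    IsOutput 𝒯 (Profile t) t'
  × (∃ λ w → IsDataWord t' w × NFAAccepts ℳ w)
  × (∀ a → a ∈ Γ₀ → Unique (valsOf a t'))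
  where open ODTA A

-- Union and intersection are built componentwise.  For A ∪ B the transducer and the output
-- alphabet are disjoint sums, so every run lives on one side; the string automaton is the union
-- of the two automata, each reading a class only if it lies inside its own side, which keeps it
-- from accepting the data word of a run of the other side.  For A ∩ B everything is a product and
-- each factor reads a class through the projection of pairs (a , b) to a, resp. b.  The subtle
-- point is the key condition: a key label a of A is spread over all pairs (a , b), so the
-- automaton also checks that no class contains two such pairs; then the a-nodes of the
-- projection have distinct values exactly when the nodes of each pair (a , b) have.
--
-- Complement fails for the ODTA `mismatch` over {a , b}, accepting the one-level trees in which
-- some b-child has another value than the child two places to its left.  Its complement contains
-- every comb of blocks (a , v+1) (a , 0) (b , u+1) (a , 0) with v = u.  An ODTA with m output
-- labels, run on such a comb of m+1 blocks with pairwise different values, gives the b-children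
-- of two blocks the same output label.  Exchanging the b-values of these two blocks changes no
-- profile, since a nonzero value is only ever compared with a separator or the root, both of
-- value 0, and it merely permutes the nodes of the output tree, so the ODTA still accepts; but
-- the new comb has a mismatch.

module Submission where

open import Defs
open import Data.Bool using (Bool; true; false; T; _∧_; if_then_else_)
import Data.Bool as Bool
open import Data.Bool.Properties using (T-∧)
open import Data.Empty using (⊥-elim)
open import Data.Fin using (Fin; zero; suc; _≟_; splitAt; _↑ˡ_; _↑ʳ_; combine; remQuot)
import Data.Fin as Fin
open import Data.Fin.Properties
  using (pigeonhole; any?; all?; +↔⊎; *↔×; splitAt-↑ˡ; splitAt-↑ʳ; splitAt⁻¹-↑ˡ; splitAt⁻¹-↑ʳ; remQuot-combine)
open import Data.Fin.Subset using (Subset; _∈_; _∪_; ⁅_⁆)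
open import Data.Fin.Subset.Properties using (_∈?_; ⊆-antisym; x∈p∪q⁻; x∈p∪q⁺; x∈⁅x⁆; x∈⁅y⁆⇒x≡y)
open import Data.List using (List; []; _∷_; _++_; map; filter; zipWith; length; lookup; upTo)
open import Data.List.Extrema.Nat using (max; xs≤max)
open import Data.List.Membership.Propositional using () renaming (_∈_ to _∈ₗ_)
open import Data.List.Membership.Propositional.Properties
  using (∈-map⁺; ∈-map⁻; ∈-filter⁺; ∈-filter⁻; ∈-AllPairs₂; ∈-lookup; ∈-∃++; ∈-upTo⁺; ∈-++⁺ʳ)
open import Data.List.Properties
  using (∷-injectiveˡ; ∷-injectiveʳ; ++-assoc; length-map; length-upTo; map-++; map-∘; map-cong; map-id;
         filter-≐; filter-none; filter-accept)
open import Data.List.Relation.Binary.Permutation.Propositional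
  using (_↭_; ↭-refl; ↭-sym; ↭-prep; ↭-swap; ↭⇒↭ₛ; module PermutationReasoning)
open import Data.List.Relation.Binary.Permutation.Propositional.Properties
  using (∈-resp-↭; map⁺; filter-↭; shift; ++⁺ˡ)
import Data.List.Relation.Binary.Permutation.Setoid.Properties as ↭ₛ
open import Data.List.Relation.Binary.Pointwise using (Pointwise; []; _∷_)
open import Data.List.Relation.Unary.All using (All; []; _∷_)
import Data.List.Relation.Unary.All as All
import Data.List.Relation.Unary.All.Properties as All
open import Data.List.Relation.Unary.AllPairs using (AllPairs; []; _∷_)
import Data.List.Relation.Unary.AllPairs.Properties as AllPairs
open import Data.List.Relation.Unary.Any using (here; there)
import Data.List.Relation.Unary.Any as Any
open import Data.List.Relation.Unary.Linked using (Linked)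
open import Data.List.Relation.Unary.Linked.Properties using (Linked⇒AllPairs; applyUpTo⁺₁)
import Data.List.Relation.Unary.Linked.Properties as Linked
open import Data.List.Relation.Unary.Unique.Propositional using (Unique)
import Data.List.Relation.Unary.Unique.Propositional.Properties as Unique
open import Data.Maybe using (Maybe; just; nothing; maybe)
open import Data.Maybe.Properties using (just-injective) renaming (≡-dec to ≡-dec-Maybe)
open import Data.Nat using (ℕ; zero; suc; _+_; _*_; _<_; s<s; s≤s)
open import Data.Nat.Properties
  using (n<1+n; ≤-refl; suc-injective; <-trans; <-asym; <-irrefl) renaming (_≟_ to _≟ℕ_)
open import Data.Product using (Σ; ∃; ∃-syntax; _×_; _,_; proj₁; proj₂; map₁)
open import Data.Product.Properties using (×-≡,≡→≡; ×-≡,≡←≡)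
open import Data.Sum using (_⊎_; inj₁; inj₂; [_,_]′)
open import Data.Unit using (⊤; tt)
open import Data.Vec using (tabulate)
open import Data.Vec.Properties using (lookup∘tabulate; []=⇒lookup; lookup⇒[]=; ≡-dec)
open import Function using (id; _∘_; _on_; const; flip; case_of_; _⇔_; mk⇔; Equivalence; _↔_; Inverse)
open import Relation.Nullary using (¬_; yes; no; does)
open import Relation.Nullary.Decidable using (dec-true; _×-dec_; _→-dec_)
open import Relation.Unary using (Pred; Decidable)
open import Relation.Binary.PropositionalEquality
  using (_≡_; _≢_; refl; sym; trans; cong; cong₂; subst; subst₂; setoid; module ≡-Reasoning)

open import Data.List.Membership.DecPropositional _≟ℕ_ using () renaming (_∈?_ to _∈ℕ?_)

open Equivalence using (to; from)

appendL≡++ : ∀ {A : Set} (xs ys : List A) → appendL xs ys ≡ xs ++ ys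
appendL≡++ []       ys = refl
appendL≡++ (x ∷ xs) ys = cong (x ∷_) (appendL≡++ xs ys)

filter-map : ∀ {A B : Set} {p} {P : Pred B p} (P? : Decidable P) (f : A → B) xs →
             filter P? (map f xs) ≡ map f (filter (P? ∘ f) xs)
filter-map P? f []       = refl
filter-map P? f (x ∷ xs) with does (P? (f x))
... | true  = cong (f x ∷_) (filter-map P? f xs)
... | false = filter-map P? f xs

filter-absorb : ∀ {A : Set} {p q} {P : Pred A p} {Q : Pred A q} (P? : Decidable P) (Q? : Decidable Q) →
                (∀ {x} → Q x → P x) → ∀ xs → filter Q? (filter P? xs) ≡ filter Q? xs
filter-absorb P? Q? Q⇒P [] = refl
filter-absorb P? Q? Q⇒P (x ∷ xs) with P? x
... | yes _ with does (Q? x)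
...   | true  = cong (x ∷_) (filter-absorb P? Q? Q⇒P xs)
...   | false = filter-absorb P? Q? Q⇒P xs
filter-absorb P? Q? Q⇒P (x ∷ xs) | no ¬px with Q? x
...   | yes qx = ⊥-elim (¬px (Q⇒P qx))
...   | no _   = filter-absorb P? Q? Q⇒P xs

allPairs-filter-tail : ∀ {A : Set} {p r} {P : Pred A p} {R : A → A → Set r} (P? : Decidable P) {x} xs →
                       AllPairs R (filter P? (x ∷ xs)) → AllPairs R (filter P? xs)
allPairs-filter-tail P? {x} xs rs with does (P? x) | rs
... | true  | _ ∷ rs′ = rs′
... | false | rs′     = rs′

length-≡-map : ∀ {A B : Set} (f : A → B) xs {ys} → map f xs ≡ ys → length xs ≡ length ys
length-≡-map f xs eq = trans (sym (length-map f xs)) (cong length eq)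

∷⁴-injective : ∀ {A : Set} {a₁ a₂ a₃ a₄ b₁ b₂ b₃ b₄ : A} {xs ys : List A} →
               _≡_ {A = List A} (a₁ ∷ a₂ ∷ a₃ ∷ a₄ ∷ xs) (b₁ ∷ b₂ ∷ b₃ ∷ b₄ ∷ ys) →
               (a₁ , a₂ , a₃ , a₄) ≡ (b₁ , b₂ , b₃ , b₄) × xs ≡ ys
∷⁴-injective refl = refl , refl

↭-exchange : ∀ {A : Set} pre (x : A) mid y post → pre ++ x ∷ mid ++ y ∷ post ↭ pre ++ y ∷ mid ++ x ∷ post
↭-exchange pre x mid y post = ++⁺ˡ pre (begin
  x ∷ mid ++ y ∷ post   ↭⟨ ↭-prep x (shift y mid post) ⟩
  x ∷ y ∷ mid ++ post   ↭⟨ ↭-swap x y ↭-refl ⟩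
  y ∷ x ∷ mid ++ post   ↭⟨ ↭-prep y (↭-sym (shift x mid post)) ⟩
  y ∷ mid ++ x ∷ post   ∎)
  where open PermutationReasoning

record TwoPicks {A : Set} (xs : List A) : Set where
  constructor picks
  field
    pre   : List A
    x     : A
    mid   : List A
    y     : A
    post  : List A
    split : xs ≡ pre ++ x ∷ mid ++ y ∷ post

picksAt : ∀ {A : Set} (xs : List A) {i j : Fin (length xs)} → i Fin.< j →
          Σ (TwoPicks xs) λ p → TwoPicks.x p ≡ lookup xs i × TwoPicks.y p ≡ lookup xs j
picksAt (z ∷ zs) {zero} {suc j} _ with ys , ws , zs≡ ← ∈-∃++ (∈-lookup {xs = zs} j) =
  picks [] z ys (lookup zs j) ws (cong (z ∷_) zs≡) , refl , refl
picksAt (z ∷ zs) {suc i} {suc j} (s<s i<j) with picks pre x mid y post zs≡ , x≡ , y≡ ← picksAt zs i<j =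
  picks (z ∷ pre) x mid y post (cong (z ∷_) zs≡) , x≡ , y≡

pigeonhole-picks : ∀ {A : Set} {m} (f : A → Fin m) xs → m < length xs →
                   Σ (TwoPicks xs) λ p → f (TwoPicks.x p) ≡ f (TwoPicks.y p)
pigeonhole-picks f xs m<len
  with i , j , i<j , fi≡fj ← pigeonhole m<len (f ∘ lookup xs)
  with p , refl , refl ← picksAt xs i<j = p , fi≡fj

map-picks : ∀ {A B : Set} (f : A → B) pre x mid y post →
            map f (pre ++ x ∷ mid ++ y ∷ post) ≡ map f pre ++ f x ∷ map f mid ++ f y ∷ map f post
map-picks f pre x mid y post = trans (map-++ f pre _) (cong (λ zs → map f pre ++ f x ∷ zs) (map-++ f mid _))

mapPicks : ∀ {A B : Set} (f : A → B) {xs} → TwoPicks xs → TwoPicks (map f xs)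
mapPicks f (picks pre x mid y post split) =
  picks (map f pre) (f x) (map f mid) (f y) (map f post) (trans (cong (map f) split) (map-picks f pre x mid y post))

module _ {A : Set} {xs : List A} where

  ∈-picks : (p : TwoPicks xs) → TwoPicks.x p ∈ₗ xs × TwoPicks.y p ∈ₗ xs
  ∈-picks (picks pre x mid y post refl) = ∈-++⁺ʳ pre (here refl) , ∈-++⁺ʳ pre (there (∈-++⁺ʳ mid (here refl)))

  picks-distinct : Unique xs → (p : TwoPicks xs) → TwoPicks.x p ≢ TwoPicks.y p
  picks-distinct unique (picks pre x mid y post refl) = go pre unique
    where
    go : ∀ pre → Unique (pre ++ x ∷ mid ++ y ∷ post) → x ≢ y
    go []        (x∉ ∷ _) = All.lookup x∉ (∈-++⁺ʳ mid (here refl))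
    go (_ ∷ pre) (_ ∷ u)  = go pre u

strictlySorted-unique : ∀ {xs ys : List ℕ} → Linked _<_ xs → Linked _<_ ys →
                        (∀ d → d ∈ₗ xs ⇔ d ∈ₗ ys) → xs ≡ ys
strictlySorted-unique xs↗ ys↗ = go (Linked⇒AllPairs <-trans xs↗) (Linked⇒AllPairs <-trans ys↗)
  where
  tail⇔ : ∀ {x xs ys} → All (x <_) xs → All (x <_) ys →
          (∀ d → d ∈ₗ x ∷ xs ⇔ d ∈ₗ x ∷ ys) → ∀ d → d ∈ₗ xs ⇔ d ∈ₗ ys
  tail⇔ {x} x<xs x<ys same d = mk⇔ (drop x<xs (to (same d) ∘ there)) (drop x<ys (from (same d) ∘ there))
    where
    drop : ∀ {zs ws} → All (x <_) zs → (d ∈ₗ zs → d ∈ₗ x ∷ ws) → d ∈ₗ zs → d ∈ₗ ws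
    drop x<zs f d∈ with f d∈
    ... | here refl = ⊥-elim (<-irrefl refl (All.lookup x<zs d∈))
    ... | there d∈ws = d∈ws

  go : ∀ {xs ys} → AllPairs _<_ xs → AllPairs _<_ ys → (∀ d → d ∈ₗ xs ⇔ d ∈ₗ ys) → xs ≡ ys
  go [] [] same = refl
  go [] (_ ∷ _) same with () ← from (same _) (here refl)
  go (_ ∷ _) [] same with () ← to (same _) (here refl)
  go {x ∷ _} {y ∷ _} (x<xs ∷ xs↗) (y<ys ∷ ys↗) same with to (same x) (here refl) | from (same y) (here refl)
  ... | there x∈ys | there y∈xs = ⊥-elim (<-asym (All.lookup y<ys x∈ys) (All.lookup x<xs y∈xs))
  ... | here refl  | _          = cong (x ∷_) (go xs↗ ys↗ (tail⇔ x<xs y<ys same))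
  ... | there _    | here refl  = cong (x ∷_) (go xs↗ ys↗ (tail⇔ x<xs y<ys same))

-- Trees, labels and data words

mutual
  mapT : ∀ {A B : Set} → (A → B) → Tree A → Tree B
  mapT f (node a ts) = node (f a) (mapF f ts)

  mapF : ∀ {A B : Set} → (A → B) → List (Tree A) → List (Tree B)
  mapF f []       = []
  mapF f (t ∷ ts) = mapT f t ∷ mapF f ts

mutual
  nodes-mapT : ∀ {A B : Set} (f : A → B) t → nodes (mapT f t) ≡ map f (nodes t)
  nodes-mapT f (node a ts) = cong (f a ∷_) (nodesF-mapF f ts)

  nodesF-mapF : ∀ {A B : Set} (f : A → B) ts → nodesF (mapF f ts) ≡ map f (nodesF ts)
  nodesF-mapF f []       = refl
  nodesF-mapF f (t ∷ ts) = begin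
    appendL (nodes (mapT f t)) (nodesF (mapF f ts)) ≡⟨ appendL≡++ (nodes (mapT f t)) _ ⟩
    nodes (mapT f t) ++ nodesF (mapF f ts)          ≡⟨ cong₂ _++_ (nodes-mapT f t) (nodesF-mapF f ts) ⟩
    map f (nodes t) ++ map f (nodesF ts)            ≡⟨ sym (map-++ f (nodes t) _) ⟩
    map f (nodes t ++ nodesF ts)                    ≡⟨ cong (map f) (sym (appendL≡++ (nodes t) _)) ⟩
    map f (appendL (nodes t) (nodesF ts))           ∎
    where open ≡-Reasoning

relabel : ∀ {m n} → (Fin m → Fin n) → Tree (Fin m × ℕ) → Tree (Fin n × ℕ)
relabel h = mapT (map₁ h)

root-relabel : ∀ {m n} (h : Fin m → Fin n) t → proj₁ (root (relabel h t)) ≡ h (proj₁ (root t))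
root-relabel h (node _ _) = refl

∈-root : ∀ {A : Set} (t : Tree A) → root t ∈ₗ nodes t
∈-root (node _ _) = here refl

leaf : ∀ {A : Set} → A → Tree A
leaf x = node x []

nodesF-leaves : ∀ {A : Set} (xs : List A) → nodesF (map leaf xs) ≡ xs
nodesF-leaves []       = refl
nodesF-leaves (x ∷ xs) = cong (x ∷_) (nodesF-leaves xs)

∈-tabulate : ∀ {n p} {P : Pred (Fin n) p} (P? : Decidable P) {x} → x ∈ tabulate (does ∘ P?) ⇔ P x
∈-tabulate {P = P} P? {x} = mk⇔
  (λ x∈ → toP (trans (sym (lookup∘tabulate _ x)) ([]=⇒lookup x∈)))
  (λ p → lookup⇒[]= x _ (trans (lookup∘tabulate _ x) (dec-true (P? x) p)))
  where
  toP : does (P? x) ≡ true → P x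
  toP eq with P? x
  ... | yes p = p

subset-ext : ∀ {n} {S S′ : Subset n} → (∀ {x} → x ∈ S ⇔ x ∈ S′) → S ≡ S′
subset-ext S⇔S′ = ⊆-antisym (to S⇔S′) (from S⇔S′)

image : ∀ {m n} → (Fin m → Fin n) → Subset m → Subset n
image h S = tabulate (does ∘ λ c → any? λ a → (a ∈? S) ×-dec (h a ≟ c))

∈-image : ∀ {m n} {h : Fin m → Fin n} {S c} → c ∈ image h S ⇔ (∃[ a ] a ∈ S × h a ≡ c)
∈-image {h = h} {S} = ∈-tabulate λ c → any? λ a → (a ∈? S) ×-dec (h a ≟ c)

preimage : ∀ {m n} → (Fin m → Fin n) → Subset n → Subset m
preimage h S = tabulate (does ∘ λ a → h a ∈? S)

∈-preimage : ∀ {m n} {h : Fin m → Fin n} {S a} → a ∈ preimage h S ⇔ h a ∈ S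
∈-preimage {h = h} {S} = ∈-tabulate λ a → h a ∈? S

module _ {m : ℕ} where

  ∈-classOf : ∀ (t : Tree (Fin m × ℕ)) {a d} → a ∈ classOf t d ⇔ (a , d) ∈ₗ nodes t
  ∈-classOf t {a} {d} = mk⇔
    (λ a∈ → Any.map (λ (e₁ , e₂) → sym (×-≡,≡→≡ (e₁ , e₂))) (to (∈-tabulate P?) a∈))
    (λ a∈ → from (∈-tabulate P?) (Any.map (λ e → ×-≡,≡←≡ (sym e)) a∈))
    where P? = λ a → Any.any? (λ x → (proj₁ x ≟ a) ×-dec (proj₂ x ≟ℕ d)) (nodes t)

  ∈-classOf⇒∈-allVals : ∀ (t : Tree (Fin m × ℕ)) {a d} → a ∈ classOf t d → d ∈ₗ allVals t
  ∈-classOf⇒∈-allVals t a∈ = ∈-map⁺ proj₂ (to (∈-classOf t) a∈)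

AcceptsDataWord : ∀ {m} → NFA (Subset m) → Tree (Fin m × ℕ) → Set
AcceptsDataWord M t = ∃ λ w → IsDataWord t w × NFAAccepts M w

KeysDistinct : ∀ {m} → Subset m → Tree (Fin m × ℕ) → Set
KeysDistinct Γ₀ t = ∀ a → a ∈ Γ₀ → Unique (valsOf a t)

acceptsDataWord-mono : ∀ {m} {M M′ : NFA (Subset m)} {t} → (∀ {w} → NFAAccepts M w → NFAAccepts M′ w) →
                       AcceptsDataWord M t → AcceptsDataWord M′ t
acceptsDataWord-mono M⊆M′ (w , dw , acc) = w , dw , M⊆M′ acc

module _ {m n : ℕ} (h : Fin m → Fin n) (t : Tree (Fin m × ℕ)) where

  nodes-relabel : nodes (relabel h t) ≡ map (map₁ h) (nodes t)
  nodes-relabel = nodes-mapT (map₁ h) t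

  classOf-relabel : ∀ d → classOf (relabel h t) d ≡ image h (classOf t d)
  classOf-relabel d = subset-ext (mk⇔ ⇒ ⇐)
    where
    ⇒ : ∀ {c} → c ∈ classOf (relabel h t) d → c ∈ image h (classOf t d)
    ⇒ c∈ with ∈-map⁻ (map₁ h) (subst ((_ , d) ∈ₗ_) nodes-relabel (to (∈-classOf (relabel h t)) c∈))
    ... | (a , .d) , a∈ , refl = from (∈-image {h = h}) (a , from (∈-classOf t) a∈ , refl)

    ⇐ : ∀ {c} → c ∈ image h (classOf t d) → c ∈ classOf (relabel h t) d
    ⇐ c∈ with to (∈-image {h = h}) c∈
    ... | a , a∈ , refl = from (∈-classOf (relabel h t))
      (subst ((h a , d) ∈ₗ_) (sym nodes-relabel) (∈-map⁺ (map₁ h) (to (∈-classOf t) a∈)))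

  allVals-relabel : allVals (relabel h t) ≡ allVals t
  allVals-relabel = trans (cong (map proj₂) nodes-relabel) (sym (map-∘ (nodes t)))

  valsOf-relabel : ∀ c → valsOf c (relabel h t) ≡ map proj₂ (filter (λ x → h (proj₁ x) ≟ c) (nodes t))
  valsOf-relabel c = begin
    map proj₂ (filter (λ x → proj₁ x ≟ c) (nodes (relabel h t)))
      ≡⟨ cong (map proj₂ ∘ filter (λ x → proj₁ x ≟ c)) nodes-relabel ⟩
    map proj₂ (filter (λ x → proj₁ x ≟ c) (map (map₁ h) (nodes t)))
      ≡⟨ cong (map proj₂) (filter-map (λ x → proj₁ x ≟ c) (map₁ h) (nodes t)) ⟩
    map proj₂ (map (map₁ h) (filter (λ x → h (proj₁ x) ≟ c) (nodes t)))
      ≡⟨ sym (map-∘ _) ⟩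
    map proj₂ (filter (λ x → h (proj₁ x) ≟ c) (nodes t)) ∎
    where open ≡-Reasoning

  map-classOf-relabel : ∀ ds → map (classOf (relabel h t)) ds ≡ map (image h) (map (classOf t) ds)
  map-classOf-relabel ds = trans (map-cong classOf-relabel ds) (map-∘ ds)

  dataWord-relabel⁺ : ∀ {w} → IsDataWord t w → IsDataWord (relabel h t) (map (image h) w)
  dataWord-relabel⁺ (ds , ds↗ , ds≈ , refl) =
    ds , ds↗ , (λ d → subst (λ vs → d ∈ₗ ds ⇔ d ∈ₗ vs) (sym allVals-relabel) (ds≈ d)) ,
    sym (map-classOf-relabel ds)

  dataWord-relabel⁻ : ∀ {w} → IsDataWord (relabel h t) w → ∃ λ v → IsDataWord t v × w ≡ map (image h) v
  dataWord-relabel⁻ (ds , ds↗ , ds≈ , refl) =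
    map (classOf t) ds ,
    (ds , ds↗ , (λ d → subst (λ vs → d ∈ₗ ds ⇔ d ∈ₗ vs) allVals-relabel (ds≈ d)) , refl) ,
    map-classOf-relabel ds

  valsOf-relabel-injective : (∀ {i j} → h i ≡ h j → i ≡ j) → ∀ a → valsOf (h a) (relabel h t) ≡ valsOf a t
  valsOf-relabel-injective h-inj a = trans (valsOf-relabel (h a))
    (cong (map proj₂) (filter-≐ _ _ ((λ eq → h-inj eq) , cong h) (nodes t)))

  valsOf-relabel-outside : ∀ c → (∀ a → h a ≢ c) → valsOf c (relabel h t) ≡ []
  valsOf-relabel-outside c outside = trans (valsOf-relabel c)
    (cong (map proj₂) (filter-none _ (All.universal (λ x → outside (proj₁ x)) (nodes t))))

module _ {m : ℕ} {t t′ : Tree (Fin m × ℕ)} (t↭t′ : nodes t ↭ nodes t′) where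

  classOf-resp-↭ : ∀ d → classOf t d ≡ classOf t′ d
  classOf-resp-↭ d = subset-ext (mk⇔
    (from (∈-classOf t′) ∘ ∈-resp-↭ t↭t′ ∘ to (∈-classOf t))
    (from (∈-classOf t) ∘ ∈-resp-↭ (↭-sym t↭t′) ∘ to (∈-classOf t′)))

  dataWord-resp-↭ : ∀ {w} → IsDataWord t w → IsDataWord t′ w
  dataWord-resp-↭ (ds , ds↗ , ds≈ , refl) =
    ds , ds↗ ,
    (λ d → mk⇔ (∈-resp-↭ (map⁺ proj₂ t↭t′) ∘ to (ds≈ d))
               (from (ds≈ d) ∘ ∈-resp-↭ (map⁺ proj₂ (↭-sym t↭t′)))) ,
    map-cong classOf-resp-↭ ds

  acceptsDataWord-resp-↭ : ∀ {M} → AcceptsDataWord M t → AcceptsDataWord M t′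
  acceptsDataWord-resp-↭ (w , dw , acc) = w , dataWord-resp-↭ dw , acc

  keysDistinct-resp-↭ : ∀ {Γ₀} → KeysDistinct Γ₀ t → KeysDistinct Γ₀ t′
  keysDistinct-resp-↭ keys a a∈ =
    ↭ₛ.Unique-resp-↭ (setoid ℕ) (↭⇒↭ₛ (map⁺ proj₂ (filter-↭ (λ x → proj₁ x ≟ a) t↭t′))) (keys a a∈)

dataWord-unique : ∀ {m} {t : Tree (Fin m × ℕ)} {w w′} → IsDataWord t w → IsDataWord t w′ → w ≡ w′
dataWord-unique {t = t} (ds , ds↗ , ds≈ , refl) (ds′ , ds′↗ , ds′≈ , refl) =
  cong (map (classOf t)) (strictlySorted-unique ds↗ ds′↗ λ d →
    mk⇔ (from (ds′≈ d) ∘ to (ds≈ d)) (from (ds≈ d) ∘ to (ds′≈ d)))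

dataWord-exists : ∀ {m} (t : Tree (Fin m × ℕ)) → ∃ (IsDataWord t)
dataWord-exists t = map (classOf t) ds , ds , ds↗ , ds≈ , refl
  where
  vs ds : List ℕ
  vs = allVals t
  ds = filter (_∈ℕ? vs) (upTo (suc (max 0 vs)))

  ds↗ : Linked _<_ ds
  ds↗ = Linked.filter⁺ (_∈ℕ? vs) <-trans (applyUpTo⁺₁ id (suc (max 0 vs)) (λ _ → ≤-refl))

  ds≈ : ∀ d → d ∈ₗ ds ⇔ d ∈ₗ vs
  ds≈ d = mk⇔ (proj₂ ∘ ∈-filter⁻ (_∈ℕ? vs))
              (λ d∈ → ∈-filter⁺ (_∈ℕ? vs) (∈-upTo⁺ (s≤s (All.lookup (xs≤max 0 vs) d∈))) d∈)

-- Automata on words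

module _ {A S : Set} (accept : S → Bool) (step : S → A → S → Bool) where

  data Path : S → List A → Set where
    done : ∀ {s} → T (accept s) → Path s []
    next : ∀ {s s′ a w} → T (step s a s′) → Path s′ w → Path s (a ∷ w)

module _ {A S : Set} {n : ℕ} (enc : Fin n ↔ S) (start accept : S → Bool) (step : S → A → S → Bool) where
  open Inverse enc using () renaming (to to state; from to index; strictlyInverseˡ to state-index)

  encodeNFA : NFA A
  encodeNFA = record
    { nst = n ; start = start ∘ state ; accept = accept ∘ state
    ; step = λ i a j → step (state i) a (state j) }

  private
    reach⇒path : ∀ {i w} → Reach encodeNFA i w → Path accept step (state i) w
    reach⇒path (done acc)    = done acc
    reach⇒path (next st rch) = next st (reach⇒path rch)

    path⇒reach : ∀ {s w} → Path accept step s w → Reach encodeNFA (index s) w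
    path⇒reach {s} (done acc) = done (subst (T ∘ accept) (sym (state-index s)) acc)
    path⇒reach {s} (next {s′ = s′} {a} st pth) =
      next (subst₂ (λ x y → T (step x a y)) (sym (state-index s)) (sym (state-index s′)) st)
           (path⇒reach pth)

  encodeNFA-accepts : ∀ {w} → NFAAccepts encodeNFA w ⇔ (∃[ s ] T (start s) × Path accept step s w)
  encodeNFA-accepts = mk⇔
    (λ (i , st , rch) → state i , st , reach⇒path rch)
    (λ (s , st , pth) → index s , subst (T ∘ start) (sym (state-index s)) st , path⇒reach pth)

module _ {A : Set} (M N : NFA A) where
  private
    module M = NFA M
    module N = NFA N

  stepUnion : Fin M.nst ⊎ Fin N.nst → A → Fin M.nst ⊎ Fin N.nst → Bool
  stepUnion (inj₁ s) a (inj₁ s′) = M.step s a s′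
  stepUnion (inj₂ s) a (inj₂ s′) = N.step s a s′
  stepUnion _        _ _         = false

  startUnion acceptUnion : Fin M.nst ⊎ Fin N.nst → Bool
  startUnion  = [ M.start , N.start ]′
  acceptUnion = [ M.accept , N.accept ]′

  unionNFA : NFA A
  unionNFA = encodeNFA +↔⊎ startUnion acceptUnion stepUnion

  private
    pathUnion⁻ : ∀ s {w} → Path acceptUnion stepUnion s w →
                 [ (λ i → Reach M i w) , (λ j → Reach N j w) ]′ s
    pathUnion⁻ (inj₁ i) (done acc) = done acc
    pathUnion⁻ (inj₂ j) (done acc) = done acc
    pathUnion⁻ (inj₁ i) (next {s′ = inj₁ i′} st pth) = next st (pathUnion⁻ (inj₁ i′) pth)
    pathUnion⁻ (inj₂ j) (next {s′ = inj₂ j′} st pth) = next st (pathUnion⁻ (inj₂ j′) pth)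

    pathUnion⁺ˡ : ∀ {i w} → Reach M i w → Path acceptUnion stepUnion (inj₁ i) w
    pathUnion⁺ˡ (done acc)    = done acc
    pathUnion⁺ˡ (next st rch) = next st (pathUnion⁺ˡ rch)

    pathUnion⁺ʳ : ∀ {j w} → Reach N j w → Path acceptUnion stepUnion (inj₂ j) w
    pathUnion⁺ʳ (done acc)    = done acc
    pathUnion⁺ʳ (next st rch) = next st (pathUnion⁺ʳ rch)

  unionNFA-accepts : ∀ {w} → NFAAccepts unionNFA w ⇔ (NFAAccepts M w ⊎ NFAAccepts N w)
  unionNFA-accepts = mk⇔ ⇒ ⇐
    where
    encoding : ∀ {w} → NFAAccepts unionNFA w ⇔ (∃[ s ] T (startUnion s) × Path acceptUnion stepUnion s w)
    encoding = encodeNFA-accepts +↔⊎ startUnion acceptUnion stepUnion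

    ⇒ : ∀ {w} → NFAAccepts unionNFA w → NFAAccepts M w ⊎ NFAAccepts N w
    ⇒ acc with to encoding acc
    ... | inj₁ i , st , pth = inj₁ (i , st , pathUnion⁻ (inj₁ i) pth)
    ... | inj₂ j , st , pth = inj₂ (j , st , pathUnion⁻ (inj₂ j) pth)

    ⇐ : ∀ {w} → NFAAccepts M w ⊎ NFAAccepts N w → NFAAccepts unionNFA w
    ⇐ (inj₁ (i , st , rch)) = from encoding (inj₁ i , st , pathUnion⁺ˡ rch)
    ⇐ (inj₂ (j , st , rch)) = from encoding (inj₂ j , st , pathUnion⁺ʳ rch)

  stepProduct : Fin M.nst × Fin N.nst → A → Fin M.nst × Fin N.nst → Bool
  stepProduct (i , j) a (i′ , j′) = M.step i a i′ ∧ N.step j a j′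

  startProduct acceptProduct : Fin M.nst × Fin N.nst → Bool
  startProduct  (i , j) = M.start i ∧ N.start j
  acceptProduct (i , j) = M.accept i ∧ N.accept j

  productNFA : NFA A
  productNFA = encodeNFA *↔× startProduct acceptProduct stepProduct

  private
    pathProduct⁻ : ∀ {i j w} → Path acceptProduct stepProduct (i , j) w →
                   Reach M i w × Reach N j w
    pathProduct⁻ (done acc) = let (accM , accN) = to T-∧ acc in done accM , done accN
    pathProduct⁻ (next st pth) =
      let (stM , stN) = to T-∧ st ; (rchM , rchN) = pathProduct⁻ pth in next stM rchM , next stN rchN

    pathProduct⁺ : ∀ {i j w} → Reach M i w → Reach N j w →
                   Path acceptProduct stepProduct (i , j) w
    pathProduct⁺ (done accM)     (done accN)     = done (from T-∧ (accM , accN))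
    pathProduct⁺ (next stM rchM) (next stN rchN) = next (from T-∧ (stM , stN)) (pathProduct⁺ rchM rchN)

  productNFA-accepts : ∀ {w} → NFAAccepts productNFA w ⇔ (NFAAccepts M w × NFAAccepts N w)
  productNFA-accepts = mk⇔
    (λ acc → let ((i , j) , st , pth) = to (encodeNFA-accepts *↔× startProduct acceptProduct stepProduct) acc
                 (stM , stN) = to T-∧ st ; (rchM , rchN) = pathProduct⁻ pth
             in (i , stM , rchM) , (j , stN , rchN))
    (λ ((i , stM , rchM) , (j , stN , rchN)) →
      from (encodeNFA-accepts *↔× startProduct acceptProduct stepProduct)
        ((i , j) , from T-∧ (stM , stN) , pathProduct⁺ rchM rchN))

ReadsAs : ∀ {X Y : Set} → (X → Maybe Y) → List X → List Y → Set
ReadsAs g = Pointwise (λ x y → g x ≡ just y)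

module _ {X Y : Set} (g : X → Maybe Y) (N : NFA Y) where
  private module N = NFA N

  stepPreimage : Fin N.nst → Maybe Y → Fin N.nst → Bool
  stepPreimage s (just y) s′ = N.step s y s′
  stepPreimage s nothing  s′ = false

  preimageNFA : NFA X
  preimageNFA = record
    { nst = N.nst ; start = N.start ; accept = N.accept
    ; step = λ s x s′ → stepPreimage s (g x) s′ }

  private
    reach⁻ : ∀ {s xs} → Reach preimageNFA s xs → ∃[ ys ] ReadsAs g xs ys × Reach N s ys
    reach⁻ (done acc) = [] , [] , done acc
    reach⁻ (next {a = x} st rch) with g x in gx | st | reach⁻ rch
    ... | just y | st′ | ys , xs≈ys , rch′ = y ∷ ys , gx ∷ xs≈ys , next st′ rch′

    reach⁺ : ∀ {s xs ys} → ReadsAs g xs ys → Reach N s ys → Reach preimageNFA s xs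
    reach⁺ [] (done acc) = done acc
    reach⁺ {s} (gx ∷ xs≈ys) (next {s' = s′} st rch) =
      next (subst (λ z → T (stepPreimage s z s′)) (sym gx) st) (reach⁺ xs≈ys rch)

  preimageNFA-accepts : ∀ {xs} → NFAAccepts preimageNFA xs ⇔ (∃[ ys ] ReadsAs g xs ys × NFAAccepts N ys)
  preimageNFA-accepts = mk⇔
    (λ (s , st , rch) → let (ys , xs≈ys , rch′) = reach⁻ rch in ys , xs≈ys , s , st , rch′)
    (λ (ys , xs≈ys , s , st , rch) → s , st , reach⁺ xs≈ys rch)

module _ {X Y : Set} (f : X → Y) (N : NFA Y) where

  mapNFA-accepts : ∀ {xs} → NFAAccepts (preimageNFA (just ∘ f) N) xs ⇔ NFAAccepts N (map f xs)
  mapNFA-accepts = mk⇔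
    (λ acc → let (ys , xs≈ys , acc′) = to (preimageNFA-accepts (just ∘ f) N) acc
             in subst (NFAAccepts N) (reads⁻ xs≈ys) acc′)
    (λ acc → from (preimageNFA-accepts (just ∘ f) N) (_ , reads⁺ _ , acc))
    where
    reads⁻ : ∀ {xs ys} → ReadsAs (just ∘ f) xs ys → ys ≡ map f xs
    reads⁻ []            = refl
    reads⁻ (refl ∷ rest) = cong (_ ∷_) (reads⁻ rest)

    reads⁺ : ∀ xs → ReadsAs (just ∘ f) xs (map f xs)
    reads⁺ []       = []
    reads⁺ (x ∷ xs) = refl ∷ reads⁺ xs

guarded : ∀ {X Y : Set} {p} {P : Pred X p} → Decidable P → (X → Y) → X → Maybe Y
guarded P? f x = if does (P? x) then just (f x) else nothing

module _ {X Y : Set} {p} {P : Pred X p} (P? : Decidable P) (f : X → Y) (N : NFA Y) where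

  guardedNFA-accepts : ∀ {xs} → NFAAccepts (preimageNFA (guarded P? f) N) xs ⇔ (All P xs × NFAAccepts N (map f xs))
  guardedNFA-accepts = mk⇔
    (λ acc → let (ys , xs≈ys , acc′) = to (preimageNFA-accepts (guarded P? f) N) acc
                 (pxs , ys≡) = reads⁻ xs≈ys
             in pxs , subst (NFAAccepts N) ys≡ acc′)
    (λ (pxs , acc) → from (preimageNFA-accepts (guarded P? f) N) (_ , reads⁺ pxs , acc))
    where
    reads⁻ : ∀ {xs ys} → ReadsAs (guarded P? f) xs ys → All P xs × ys ≡ map f xs
    reads⁻ [] = [] , refl
    reads⁻ {x ∷ _} (gx ∷ rest) with P? x | gx
    ... | yes px | refl = let (pxs , ys≡) = reads⁻ rest in px ∷ pxs , cong (f x ∷_) ys≡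

    reads⁺ : ∀ {xs} → All P xs → ReadsAs (guarded P? f) xs (map f xs)
    reads⁺ [] = []
    reads⁺ {x ∷ _} (px ∷ pxs) = cong (if_then just (f x) else nothing) (dec-true (P? x) px) ∷ reads⁺ pxs

acceptsDataWord-product : ∀ {m} {M N : NFA (Subset m)} {t} →
                          AcceptsDataWord (productNFA M N) t ⇔ (AcceptsDataWord M t × AcceptsDataWord N t)
acceptsDataWord-product {M = M} {N} = mk⇔
  (λ (w , dw , acc) → let (accM , accN) = to (productNFA-accepts M N) acc in (w , dw , accM) , (w , dw , accN))
  (λ ((w , dw , accM) , (w′ , dw′ , accN)) →
    w , dw , from (productNFA-accepts M N) (accM , subst (NFAAccepts N) (sym (dataWord-unique dw dw′)) accN))

-- Transducers

record Embedding (m n : ℕ) : Set where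
  field
    embed         : Fin m → Fin n
    restore       : Fin n → Maybe (Fin m)
    restore-embed : ∀ i → restore (embed i) ≡ just i
    embed-restore : ∀ {c i} → restore c ≡ just i → embed i ≡ c

  embed-injective : ∀ {i j} → embed i ≡ embed j → i ≡ j
  embed-injective {i} {j} eq = just-injective (trans (sym (restore-embed i)) (trans (cong restore eq) (restore-embed j)))

  readsAs-restore : ∀ {cs is} → ReadsAs restore cs is → cs ≡ map embed is
  readsAs-restore []           = refl
  readsAs-restore (eq ∷ rest) = cong₂ _∷_ (sym (embed-restore eq)) (readsAs-restore rest)

  readsAs-embed : ∀ is → ReadsAs restore (map embed is) is
  readsAs-embed []       = []
  readsAs-embed (i ∷ is) = restore-embed i ∷ readsAs-embed is

inlEmbedding : ∀ m n → Embedding m (m + n)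
inlEmbedding m n = record
  { embed         = _↑ˡ n
  ; restore       = [ just , const nothing ]′ ∘ splitAt m
  ; restore-embed = λ i → cong [ just , const nothing ]′ (splitAt-↑ˡ m i n)
  ; embed-restore = λ {c} → restore⁻ (splitAt m c) refl
  }
  where
  restore⁻ : ∀ {c i} s → splitAt m c ≡ s → [ just , const nothing ]′ s ≡ just i → i ↑ˡ n ≡ c
  restore⁻ (inj₁ _) eq refl = splitAt⁻¹-↑ˡ eq

inrEmbedding : ∀ m n → Embedding n (m + n)
inrEmbedding m n = record
  { embed         = m ↑ʳ_
  ; restore       = [ const nothing , just ]′ ∘ splitAt m
  ; restore-embed = λ j → cong [ const nothing , just ]′ (splitAt-↑ʳ m n j)
  ; embed-restore = λ {c} → restore⁻ (splitAt m c) refl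
  }
  where
  restore⁻ : ∀ {c j} s → splitAt m c ≡ s → [ const nothing , just ]′ s ≡ just j → m ↑ʳ j ≡ c
  restore⁻ (inj₂ _) eq refl = splitAt⁻¹-↑ʳ eq

inl≢inr : ∀ {m n} (i : Fin m) (j : Fin n) → i ↑ˡ n ≢ m ↑ʳ j
inl≢inr {m} {n} i j eq with trans (sym (splitAt-↑ˡ m i n)) (trans (cong (splitAt m) eq) (splitAt-↑ʳ m n j))
... | ()

T-maybe : ∀ {A : Set} {f : A → Bool} {x} → T (maybe f false x) → ∃[ a ] x ≡ just a × T (f a)
T-maybe {x = just a} t = a , refl , t

module EmbeddedRuns {k m n : ℕ} (X : Transducer k m) (C : Transducer k n)
  (ιQ : Embedding (Transducer.nQ X) (Transducer.nQ C)) (ιΓ : Embedding m n)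
  (δ-embed : ∀ q L → Transducer.δ C (Embedding.embed ιQ q) L ≡
                     preimageNFA (Embedding.restore ιQ) (Transducer.δ X q L))
  (μ-embed : ∀ q L c → Transducer.μ C (Embedding.embed ιQ q) L c ≡
                       maybe (Transducer.μ X q L) false (Embedding.restore ιΓ c))
  where

  private
    module X = Transducer X
    module C = Transducer C
    module ιQ = Embedding ιQ
    module ιΓ = Embedding ιΓ

  mutual
    out⁺ : ∀ {q s t} → Out X q s t → Out C (ιQ.embed q) s (relabel ιΓ.embed t)
    out⁺ {q} (node {a = L} {b} {qs = qs} μ acc outs) =
      node (subst T (sym (trans (μ-embed q L (ιΓ.embed b)) (cong (maybe (X.μ q L) false) (ιΓ.restore-embed b)))) μ)
           (subst (λ N → NFAAccepts N (map ιQ.embed qs)) (sym (δ-embed q L))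
             (from (preimageNFA-accepts ιQ.restore (X.δ q L)) (qs , ιQ.readsAs-embed qs , acc)))
           (outs⁺ outs)

    outs⁺ : ∀ {qs ss ts} → Outs X qs ss ts → Outs C (map ιQ.embed qs) ss (mapF (map₁ ιΓ.embed) ts)
    outs⁺ []           = []
    outs⁺ (out ∷ outs) = out⁺ out ∷ outs⁺ outs

  mutual
    out⁻ : ∀ {q s t″} → Out C (ιQ.embed q) s t″ → ∃[ t ] t″ ≡ relabel ιΓ.embed t × Out X q s t
    out⁻ {q} (node {a = L} {c} {d} μ acc outs)
      with T-maybe (subst T (μ-embed q L c) μ)
         | to (preimageNFA-accepts ιQ.restore (X.δ q L)) (subst (λ N → NFAAccepts N _) (δ-embed q L) acc)
    ... | b , restore≡ , μX | qs , reads , accX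
      with refl ← ιΓ.embed-restore restore≡ | refl ← ιQ.readsAs-restore reads
      with ts , refl , outsX ← outs⁻ qs outs
      = node (b , d) ts , refl , node μX accX outsX

    outs⁻ : ∀ qs {ss ts″} → Outs C (map ιQ.embed qs) ss ts″ →
            ∃[ ts ] ts″ ≡ mapF (map₁ ιΓ.embed) ts × Outs X qs ss ts
    outs⁻ []       []           = [] , refl , []
    outs⁻ (q ∷ qs) (out ∷ outs) with t , refl , outX ← out⁻ out | ts , refl , outsX ← outs⁻ qs outs
      = t ∷ ts , refl , outX ∷ outsX

module TransducerSum {k mA mB : ℕ} (A : Transducer k mA) (B : Transducer k mB) where
  private
    module A = Transducer A
    module B = Transducer B
    module ιQˡ = Embedding (inlEmbedding A.nQ B.nQ)
    module ιQʳ = Embedding (inrEmbedding A.nQ B.nQ)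
    module ιΓˡ = Embedding (inlEmbedding mA mB)
    module ιΓʳ = Embedding (inrEmbedding mA mB)

  finalSum : Fin A.nQ ⊎ Fin B.nQ → Bool
  finalSum = [ A.final , B.final ]′

  δSum : PLetter k → Fin A.nQ ⊎ Fin B.nQ → NFA (Fin (A.nQ + B.nQ))
  δSum L = [ (λ i → preimageNFA ιQˡ.restore (A.δ i L)) , (λ j → preimageNFA ιQʳ.restore (B.δ j L)) ]′

  μSum : PLetter k → Fin (mA + mB) → Fin A.nQ ⊎ Fin B.nQ → Bool
  μSum L c = [ (λ i → maybe (A.μ i L) false (ιΓˡ.restore c)) , (λ j → maybe (B.μ j L) false (ιΓʳ.restore c)) ]′

  sum : Transducer k (mA + mB)
  sum = record
    { nQ    = A.nQ + B.nQ
    ; final = finalSum ∘ splitAt A.nQ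
    ; δ     = λ q L → δSum L (splitAt A.nQ q)
    ; μ     = λ q L c → μSum L c (splitAt A.nQ q)
    }

  module Left = EmbeddedRuns A sum (inlEmbedding A.nQ B.nQ) (inlEmbedding mA mB)
    (λ i L → cong (δSum L) (splitAt-↑ˡ A.nQ i B.nQ)) (λ i L c → cong (μSum L c) (splitAt-↑ˡ A.nQ i B.nQ))

  module Right = EmbeddedRuns B sum (inrEmbedding A.nQ B.nQ) (inrEmbedding mA mB)
    (λ j L → cong (δSum L) (splitAt-↑ʳ A.nQ B.nQ j)) (λ j L c → cong (μSum L c) (splitAt-↑ʳ A.nQ B.nQ j))

  final-inl : ∀ i → Transducer.final sum (i ↑ˡ B.nQ) ≡ A.final i
  final-inl i = cong finalSum (splitAt-↑ˡ A.nQ i B.nQ)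

  final-inr : ∀ j → Transducer.final sum (A.nQ ↑ʳ j) ≡ B.final j
  final-inr j = cong finalSum (splitAt-↑ʳ A.nQ B.nQ j)

module _ {m n : ℕ} where

  π₁ : Fin (m * n) → Fin m
  π₁ = proj₁ ∘ remQuot {m} n

  π₂ : Fin (m * n) → Fin n
  π₂ = proj₂ ∘ remQuot {m} n

  π₁-combine : ∀ i j → π₁ (combine i j) ≡ i
  π₁-combine i j = cong proj₁ (remQuot-combine {m} {n} i j)

  π₂-combine : ∀ i j → π₂ (combine i j) ≡ j
  π₂-combine i j = cong proj₂ (remQuot-combine {m} {n} i j)

module TransducerProduct {k mA mB : ℕ} (A : Transducer k mA) (B : Transducer k mB) where
  private
    module A = Transducer A
    module B = Transducer B

  fstQ : Fin (A.nQ * B.nQ) → Fin A.nQ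
  fstQ = π₁ {A.nQ} {B.nQ}
  sndQ : Fin (A.nQ * B.nQ) → Fin B.nQ
  sndQ = π₂ {A.nQ} {B.nQ}
  fstΓ : Fin (mA * mB) → Fin mA
  fstΓ = π₁ {mA} {mB}
  sndΓ : Fin (mA * mB) → Fin mB
  sndΓ = π₂ {mA} {mB}

  product : Transducer k (mA * mB)
  product = record
    { nQ    = A.nQ * B.nQ
    ; final = λ q → A.final (fstQ q) ∧ B.final (sndQ q)
    ; δ     = λ q L → productNFA (preimageNFA (just ∘ fstQ) (A.δ (fstQ q) L))
                                 (preimageNFA (just ∘ sndQ) (B.δ (sndQ q) L))
    ; μ     = λ q L c → A.μ (fstQ q) L (fstΓ c) ∧ B.μ (sndQ q) L (sndΓ c)
    }

  mutual
    out⁻ : ∀ {q s t} → Out product q s t → Out A (fstQ q) s (relabel fstΓ t) × Out B (sndQ q) s (relabel sndΓ t)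
    out⁻ {q} (node {a = L} {qs = qs} μ acc outs) =
      let (μA , μB) = to T-∧ μ
          (accA , accB) = to (productNFA-accepts _ _) acc
          (outsA , outsB) = outs⁻ outs
      in node μA (to (mapNFA-accepts fstQ (A.δ (fstQ q) L)) accA) outsA ,
         node μB (to (mapNFA-accepts sndQ (B.δ (sndQ q) L)) accB) outsB

    outs⁻ : ∀ {qs ss ts} → Outs product qs ss ts →
            Outs A (map fstQ qs) ss (mapF (map₁ fstΓ) ts) × Outs B (map sndQ qs) ss (mapF (map₁ sndΓ) ts)
    outs⁻ []           = [] , []
    outs⁻ (out ∷ outs) =
      let (outA , outB) = out⁻ out ; (outsA , outsB) = outs⁻ outs in outA ∷ outsA , outB ∷ outsB

  private
    map-π-zipWith : ∀ {is js ss tsA tsB} → Outs A is ss tsA → Outs B js ss tsB →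
                    map fstQ (zipWith combine is js) ≡ is × map sndQ (zipWith combine is js) ≡ js
    map-π-zipWith [] [] = refl , refl
    map-π-zipWith (_∷_ {q = i} _ outsA) (_∷_ {q = j} _ outsB) =
      let (eq₁ , eq₂) = map-π-zipWith outsA outsB
      in cong₂ _∷_ (π₁-combine i j) eq₁ , cong₂ _∷_ (π₂-combine i j) eq₂

  mutual
    out⁺ : ∀ {i j s tA tB} → Out A i s tA → Out B j s tB →
           ∃[ t ] Out product (combine i j) s t × relabel fstΓ t ≡ tA × relabel sndΓ t ≡ tB
    out⁺ {i} {j} (node {a = L} {a} {d} {qs = is} μA accA outsA) (node {b = b} {qs = js} μB accB outsB)
      with ts , outs , refl , refl ← outs⁺ outsA outsB =
      node (combine a b , d) ts ,
      node (from T-∧ ( subst₂ (λ q c → T (A.μ q L c)) (sym (π₁-combine i j)) (sym (π₁-combine a b)) μA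
                     , subst₂ (λ q c → T (B.μ q L c)) (sym (π₂-combine i j)) (sym (π₂-combine a b)) μB))
           (from (productNFA-accepts _ _)
             ( from (mapNFA-accepts fstQ _) (subst₂ (λ q → NFAAccepts (A.δ q L)) (sym (π₁-combine i j)) (sym is≡) accA)
             , from (mapNFA-accepts sndQ _) (subst₂ (λ q → NFAAccepts (B.δ q L)) (sym (π₂-combine i j)) (sym js≡) accB)))
           outs ,
      cong (λ c → node (c , d) _) (π₁-combine a b) , cong (λ c → node (c , d) _) (π₂-combine a b)
      where
      is≡ : map fstQ (zipWith combine is js) ≡ is
      is≡ = proj₁ (map-π-zipWith outsA outsB)
      js≡ : map sndQ (zipWith combine is js) ≡ js
      js≡ = proj₂ (map-π-zipWith outsA outsB)

    outs⁺ : ∀ {is js ss tsA tsB} → Outs A is ss tsA → Outs B js ss tsB →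
            ∃[ ts ] Outs product (zipWith combine is js) ss ts ×
                    mapF (map₁ fstΓ) ts ≡ tsA × mapF (map₁ sndΓ) ts ≡ tsB
    outs⁺ [] [] = [] , [] , refl , refl
    outs⁺ (outA ∷ outsA) (outB ∷ outsB)
      with t , out , refl , refl ← out⁺ outA outB | ts , outs , refl , refl ← outs⁺ outsA outsB
      = t ∷ ts , out ∷ outs , refl , refl

-- Union

module EmbeddedLabels {m n : ℕ} (e : Embedding m n) where
  open Embedding e

  InRange : Subset n → Set
  InRange S = image embed (preimage embed S) ≡ S

  inRange? : Decidable InRange
  inRange? S = ≡-dec Bool._≟_ (image embed (preimage embed S)) S

  preimage-image : ∀ S → preimage embed (image embed S) ≡ S
  preimage-image S = subset-ext (mk⇔
    (λ a∈ → let (a′ , a′∈ , eq) = to (∈-image {h = embed}) (to (∈-preimage {h = embed}) a∈)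
            in subst (_∈ S) (embed-injective eq) a′∈)
    (λ a∈ → from (∈-preimage {h = embed}) (from (∈-image {h = embed}) (_ , a∈ , refl))))

  restrictNFA : NFA (Subset m) → NFA (Subset n)
  restrictNFA = preimageNFA (guarded inRange? (preimage embed))

  map-preimage-image : ∀ w → map (preimage embed) (map (image embed) w) ≡ w
  map-preimage-image w = trans (sym (map-∘ w)) (trans (map-cong preimage-image w) (map-id w))

  acceptsDataWord-embed⁺ : ∀ {M t} → AcceptsDataWord M t → AcceptsDataWord (restrictNFA M) (relabel embed t)
  acceptsDataWord-embed⁺ {M} {t} (w , dw , acc) =
    map (image embed) w , dataWord-relabel⁺ embed t dw ,
    from (guardedNFA-accepts inRange? (preimage embed) M)
      (All.map⁺ (All.universal (λ S → cong (image embed) (preimage-image S)) w) ,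
       subst (NFAAccepts M) (sym (map-preimage-image w)) acc)

  acceptsDataWord-embed⁻ : ∀ {M t} → AcceptsDataWord (restrictNFA M) (relabel embed t) → AcceptsDataWord M t
  acceptsDataWord-embed⁻ {M} {t} (w″ , dw″ , acc″) =
    let (w , dw , w″≡) = dataWord-relabel⁻ embed t dw″
        (_ , acc) = to (guardedNFA-accepts inRange? (preimage embed) M) acc″
    in w , dw , subst (NFAAccepts M) (trans (cong (map (preimage embed)) w″≡) (map-preimage-image w)) acc

  restrictNFA-rejects : ∀ {M} (t : Tree (Fin n × ℕ)) → (∀ a → embed a ≢ proj₁ (root t)) →
                        ¬ AcceptsDataWord (restrictNFA M) t
  restrictNFA-rejects {M} t outside (w , (ds , _ , ds≈ , refl) , acc)
    with rootIn ← All.lookup (proj₁ (to (guardedNFA-accepts inRange? (preimage embed) M) acc))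
                    (∈-map⁺ (classOf t) (from (ds≈ (rootVal t)) (∈-map⁺ proj₂ (∈-root t))))
    with a , _ , eq ← to (∈-image {h = embed}) (subst (proj₁ (root t) ∈_) (sym rootIn) (from (∈-classOf t) (∈-root t)))
    = outside a eq

  keysDistinct-embed⁺ : ∀ {Γ₀} t → KeysDistinct Γ₀ t →
                        ∀ c → c ∈ image embed Γ₀ → Unique (valsOf c (relabel embed t))
  keysDistinct-embed⁺ t keys c c∈ with a , a∈ , refl ← to (∈-image {h = embed}) c∈ =
    subst Unique (sym (valsOf-relabel-injective embed t embed-injective a)) (keys a a∈)

  keysDistinct-embed⁻ : ∀ {Γ₀} t → (∀ c → c ∈ image embed Γ₀ → Unique (valsOf c (relabel embed t))) →
                        KeysDistinct Γ₀ t
  keysDistinct-embed⁻ t keys a a∈ =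
    subst Unique (valsOf-relabel-injective embed t embed-injective a)
                 (keys (embed a) (from (∈-image {h = embed}) (a , a∈ , refl)))

module Union {k : ℕ} (A B : ODTA k) where
  private
    module A = ODTA A
    module B = ODTA B
    module Lˡ = EmbeddedLabels (inlEmbedding A.m B.m)
    module Lʳ = EmbeddedLabels (inrEmbedding A.m B.m)
    module TA = Transducer A.𝒯
  open TransducerSum A.𝒯 B.𝒯

  inl : Fin A.m → Fin (A.m + B.m)
  inl = _↑ˡ B.m

  inr : Fin B.m → Fin (A.m + B.m)
  inr = A.m ↑ʳ_

  union : ODTA k
  union = record
    { m  = A.m + B.m
    ; 𝒯  = sum
    ; ℳ  = unionNFA (Lˡ.restrictNFA A.ℳ) (Lʳ.restrictNFA B.ℳ)
    ; Γ₀ = image inl A.Γ₀ ∪ image inr B.Γ₀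
    }

  private
    module U = ODTA union

  accepts⁺ˡ : ∀ {t} → ODTAAccepts A t → ODTAAccepts union t
  accepts⁺ˡ (t′ , (q , fin , out) , dw , keys) =
    relabel inl t′ ,
    (_ , subst T (sym (final-inl q)) fin , Left.out⁺ out) ,
    acceptsDataWord-mono (from (unionNFA-accepts _ _) ∘ inj₁) (Lˡ.acceptsDataWord-embed⁺ dw) ,
    λ c c∈ → case x∈p∪q⁻ _ _ c∈ of λ
      { (inj₁ c∈ˡ) → Lˡ.keysDistinct-embed⁺ t′ keys c c∈ˡ
      ; (inj₂ c∈ʳ) → let (b , _ , eq) = to (∈-image {h = inr}) c∈ʳ in
          subst Unique (sym (valsOf-relabel-outside inl t′ c (λ a → inl≢inr a b ∘ flip trans (sym eq)))) [] }

  accepts⁺ʳ : ∀ {t} → ODTAAccepts B t → ODTAAccepts union t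
  accepts⁺ʳ (t′ , (q , fin , out) , dw , keys) =
    relabel inr t′ ,
    (_ , subst T (sym (final-inr q)) fin , Right.out⁺ out) ,
    acceptsDataWord-mono (from (unionNFA-accepts _ _) ∘ inj₂) (Lʳ.acceptsDataWord-embed⁺ dw) ,
    λ c c∈ → case x∈p∪q⁻ _ _ c∈ of λ
      { (inj₁ c∈ˡ) → let (a , _ , eq) = to (∈-image {h = inl}) c∈ˡ in
          subst Unique (sym (valsOf-relabel-outside inr t′ c (λ b → inl≢inr a b ∘ trans eq ∘ sym))) []
      ; (inj₂ c∈ʳ) → Lʳ.keysDistinct-embed⁺ t′ keys c c∈ʳ }

  acceptsDataWord-inl⁻ : ∀ {t′} → AcceptsDataWord U.ℳ (relabel inl t′) → AcceptsDataWord A.ℳ t′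
  acceptsDataWord-inl⁻ {t′} (w , dw , acc) with to (unionNFA-accepts _ _) acc
  ... | inj₁ accˡ = Lˡ.acceptsDataWord-embed⁻ (w , dw , accˡ)
  ... | inj₂ accʳ = ⊥-elim (Lʳ.restrictNFA-rejects (relabel inl t′)
                      (λ b eq → inl≢inr _ b (sym (trans eq (root-relabel inl t′)))) (w , dw , accʳ))

  acceptsDataWord-inr⁻ : ∀ {t′} → AcceptsDataWord U.ℳ (relabel inr t′) → AcceptsDataWord B.ℳ t′
  acceptsDataWord-inr⁻ {t′} (w , dw , acc) with to (unionNFA-accepts _ _) acc
  ... | inj₁ accˡ = ⊥-elim (Lˡ.restrictNFA-rejects (relabel inr t′)
                      (λ a eq → inl≢inr a _ (trans eq (root-relabel inr t′))) (w , dw , accˡ))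
  ... | inj₂ accʳ = Lʳ.acceptsDataWord-embed⁻ (w , dw , accʳ)

  accepts⁻ : ∀ {t} → ODTAAccepts union t → ODTAAccepts A t ⊎ ODTAAccepts B t
  accepts⁻ (t″ , (q , fin , out) , dw , keys) with splitAt TA.nQ q in eq
  ... | inj₁ i with refl ← splitAt⁻¹-↑ˡ eq with t′ , refl , outA ← Left.out⁻ out =
    inj₁ (t′ , (i , fin , outA) , acceptsDataWord-inl⁻ dw ,
          Lˡ.keysDistinct-embed⁻ t′ λ c c∈ → keys c (x∈p∪q⁺ (inj₁ c∈)))
  ... | inj₂ j with refl ← splitAt⁻¹-↑ʳ eq with t′ , refl , outB ← Right.out⁻ out =
    inj₂ (t′ , (j , fin , outB) , acceptsDataWord-inr⁻ dw ,
          Lʳ.keysDistinct-embed⁻ t′ λ c c∈ → keys c (x∈p∪q⁺ (inj₂ c∈)))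

  union-correct : ∀ t → ODTAAccepts union t ⇔ (ODTAAccepts A t ⊎ ODTAAccepts B t)
  union-correct t = mk⇔ accepts⁻ [ accepts⁺ˡ , accepts⁺ʳ ]′

-- Intersection

module _ {m : ℕ} where

  DistinctValues : List (Fin m × ℕ) → Set
  DistinctValues = AllPairs (_≢_ on proj₂)

  unique⇔distinctValues : ∀ {xs} → Unique (map proj₂ xs) ⇔ DistinctValues xs
  unique⇔distinctValues = mk⇔ AllPairs.map⁻ AllPairs.map⁺

  withLabel : Fin m → List (Fin m × ℕ) → List (Fin m × ℕ)
  withLabel c = filter (λ x → proj₁ x ≟ c)

  distinctValues-byLabel : ∀ xs → (∀ {x} → x ∈ₗ xs → DistinctValues (withLabel (proj₁ x) xs)) →
                           (∀ {x y} → x ∈ₗ xs → y ∈ₗ xs → proj₂ x ≡ proj₂ y → proj₁ x ≡ proj₁ y) →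
                           DistinctValues xs
  distinctValues-byLabel []       _        _         = []
  distinctValues-byLabel (x ∷ xs) perLabel sameLabel =
    All.tabulate (λ y∈ eq → headDistinct y∈ eq) ∷
    distinctValues-byLabel xs
      (λ {y} y∈ → allPairs-filter-tail (λ z → proj₁ z ≟ proj₁ y) {x} xs (perLabel (there y∈)))
                              (λ x∈ y∈ → sameLabel (there x∈) (there y∈))
    where
    headDistinct : ∀ {y} → y ∈ₗ xs → proj₂ x ≢ proj₂ y
    headDistinct y∈ eq
      with x∉ ∷ _ ← subst DistinctValues (filter-accept (λ y → proj₁ y ≟ proj₁ x) refl) (perLabel (here refl))
      = All.lookup x∉ (∈-filter⁺ _ y∈ (sym (sameLabel (here refl) (there y∈) eq))) eq

module _ {m n : ℕ} (π : Fin m → Fin n) (a : Fin n) where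

  inFibre : List (Fin m × ℕ) → List (Fin m × ℕ)
  inFibre = filter (λ x → π (proj₁ x) ≟ a)

  FibreInjectiveOn : List (Fin m × ℕ) → Set
  FibreInjectiveOn ns = ∀ {c c′ d} → (c , d) ∈ₗ ns → (c′ , d) ∈ₗ ns → π c ≡ a → π c′ ≡ a → c ≡ c′

  distinctValues-fibre : ∀ ns → DistinctValues (inFibre ns) ⇔
    ((∀ c → π c ≡ a → DistinctValues (withLabel c ns)) × FibreInjectiveOn ns)
  distinctValues-fibre ns = mk⇔ ⇒ ⇐
    where
    withLabel-inFibre : ∀ {c} → π c ≡ a → withLabel c (inFibre ns) ≡ withLabel c ns
    withLabel-inFibre πc≡a = filter-absorb _ _ (λ { refl → πc≡a }) ns

    ⇒ : DistinctValues (inFibre ns) → (∀ c → π c ≡ a → DistinctValues (withLabel c ns)) × FibreInjectiveOn ns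
    ⇒ fibre! =
      (λ c πc≡a → subst DistinctValues (withLabel-inFibre πc≡a) (AllPairs.filter⁺ _ fibre!)) ,
      (λ {c} {c′} c∈ c′∈ πc≡a πc′≡a →
        case ∈-AllPairs₂ fibre! (∈-filter⁺ _ c∈ πc≡a) (∈-filter⁺ _ c′∈ πc′≡a) of λ
          { (inj₁ eq)        → cong proj₁ eq
          ; (inj₂ (inj₁ ≢)) → ⊥-elim (≢ refl)
          ; (inj₂ (inj₂ ≢)) → ⊥-elim (≢ refl) })

    ⇐ : (∀ c → π c ≡ a → DistinctValues (withLabel c ns)) × FibreInjectiveOn ns → DistinctValues (inFibre ns)
    ⇐ (perLabel , injective) = distinctValues-byLabel (inFibre ns)
      (λ x∈ → let (_ , πx≡a) = ∈-filter⁻ (λ x → π (proj₁ x) ≟ a) {xs = ns} x∈ in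
        subst DistinctValues (sym (withLabel-inFibre πx≡a)) (perLabel _ πx≡a))
      (λ {(c , d)} {(c′ , d′)} x∈ y∈ d≡d′ →
        let (c∈ , πc≡a) = ∈-filter⁻ (λ x → π (proj₁ x) ≟ a) {xs = ns} x∈
            (c′∈ , πc′≡a) = ∈-filter⁻ (λ x → π (proj₁ x) ≟ a) {xs = ns} y∈ in
        injective c∈ (subst (λ e → (c′ , e) ∈ₗ ns) (sym d≡d′) c′∈) πc≡a πc′≡a)

module ProjectedLabels {m n : ℕ} (π : Fin m → Fin n) (Γ₀ : Subset n) where

  FibreInjective : Subset m → Set
  FibreInjective S = ∀ c c′ → c ∈ S → c′ ∈ S → π c ∈ Γ₀ → π c ≡ π c′ → c ≡ c′

  fibreInjective? : Decidable FibreInjective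
  fibreInjective? S = all? λ c → all? λ c′ →
    (c ∈? S) →-dec (c′ ∈? S) →-dec (π c ∈? Γ₀) →-dec (π c ≟ π c′) →-dec (c ≟ c′)

  FibresInjective : Tree (Fin m × ℕ) → Set
  FibresInjective t = ∀ d → FibreInjective (classOf t d)

  projectNFA : NFA (Subset n) → NFA (Subset m)
  projectNFA = preimageNFA (guarded fibreInjective? (image π))

  module _ {t : Tree (Fin m × ℕ)} where

    fibresInjective⇒all : ∀ {w} → IsDataWord t w → FibresInjective t → All FibreInjective w
    fibresInjective⇒all (ds , _ , _ , refl) fibres = All.map⁺ (All.universal fibres ds)

    all⇒fibresInjective : ∀ {w} → IsDataWord t w → All FibreInjective w → FibresInjective t
    all⇒fibresInjective (ds , _ , ds≈ , refl) all d c c′ c∈ =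
      All.lookup all (∈-map⁺ (classOf t) (from (ds≈ d) (∈-classOf⇒∈-allVals t c∈))) c c′ c∈

  acceptsDataWord-project : ∀ {M t} →
    AcceptsDataWord (projectNFA M) t ⇔ (FibresInjective t × AcceptsDataWord M (relabel π t))
  acceptsDataWord-project {M} {t} = mk⇔
    (λ (w , dw , acc) → let (fibres , acc′) = to (guardedNFA-accepts fibreInjective? (image π) M) acc in
      all⇒fibresInjective dw fibres , map (image π) w , dataWord-relabel⁺ π t dw , acc′)
    (λ (fibres , w′ , dw′ , acc′) → let (w , dw , w′≡) = dataWord-relabel⁻ π t dw′ in
      w , dw , from (guardedNFA-accepts fibreInjective? (image π) M)
                 (fibresInjective⇒all dw fibres , subst (NFAAccepts M) w′≡ acc′))

  keysDistinct-project : ∀ t → KeysDistinct Γ₀ (relabel π t) ⇔ (FibresInjective t × KeysDistinct (preimage π Γ₀) t)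
  keysDistinct-project t = mk⇔
    (λ keys → (λ d c c′ c∈ c′∈ πc∈ πc≡πc′ →
                 proj₂ (fibre (keys (π c) πc∈)) (to (∈-classOf t) c∈) (to (∈-classOf t) c′∈) refl (sym πc≡πc′)) ,
              (λ c c∈ → from unique⇔distinctValues (proj₁ (fibre (keys (π c) (to (∈-preimage {h = π}) c∈))) c refl)))
    (λ (fibres , keys) a a∈ → subst Unique (sym (valsOf-relabel π t a)) (from unique⇔distinctValues
      (from (distinctValues-fibre π a (nodes t))
        ( (λ { c refl → to unique⇔distinctValues (keys c (from (∈-preimage {h = π}) a∈)) })
        , (λ { c∈ c′∈ refl πc′≡a → fibres _ _ _ (from (∈-classOf t) c∈) (from (∈-classOf t) c′∈) a∈ (sym πc′≡a) })))))
    where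
    fibre : ∀ {a} → Unique (valsOf a (relabel π t)) →
            (∀ c → π c ≡ a → DistinctValues (withLabel c (nodes t))) × FibreInjectiveOn π a (nodes t)
    fibre {a} unique = to (distinctValues-fibre π a (nodes t))
      (to unique⇔distinctValues (subst Unique (valsOf-relabel π t a) unique))

module Intersection {k : ℕ} (A B : ODTA k) where
  private
    module A = ODTA A
    module B = ODTA B
  open TransducerProduct A.𝒯 B.𝒯
  private
    module PA = ProjectedLabels fstΓ A.Γ₀
    module PB = ProjectedLabels sndΓ B.Γ₀

  intersection : ODTA k
  intersection = record
    { m  = A.m * B.m
    ; 𝒯  = product
    ; ℳ  = productNFA (PA.projectNFA A.ℳ) (PB.projectNFA B.ℳ)
    ; Γ₀ = preimage fstΓ A.Γ₀ ∪ preimage sndΓ B.Γ₀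
    }

  accepts⁻ : ∀ {t} → ODTAAccepts intersection t → ODTAAccepts A t × ODTAAccepts B t
  accepts⁻ (t″ , (q , fin , out) , dw , keys) =
    let (outA , outB) = out⁻ out
        (finA , finB) = to T-∧ fin
        (dwA , dwB) = to acceptsDataWord-product dw
        (fibresA , dwA′) = to PA.acceptsDataWord-project dwA
        (fibresB , dwB′) = to PB.acceptsDataWord-project dwB
    in (relabel fstΓ t″ , (fstQ q , finA , outA) , dwA′ ,
        from (PA.keysDistinct-project t″) (fibresA , λ c c∈ → keys c (x∈p∪q⁺ (inj₁ c∈)))) ,
       (relabel sndΓ t″ , (sndQ q , finB , outB) , dwB′ ,
        from (PB.keysDistinct-project t″) (fibresB , λ c c∈ → keys c (x∈p∪q⁺ (inj₂ c∈))))

  accepts⁺ : ∀ {t} → ODTAAccepts A t → ODTAAccepts B t → ODTAAccepts intersection t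
  accepts⁺ (_ , (i , finA , outA) , dwA , keysA) (_ , (j , finB , outB) , dwB , keysB)
    with t″ , out , refl , refl ← out⁺ outA outB =
    let (fibresA , keysA′) = to (PA.keysDistinct-project t″) keysA
        (fibresB , keysB′) = to (PB.keysDistinct-project t″) keysB
    in t″ ,
       (combine i j , from T-∧ ( subst (T ∘ Transducer.final A.𝒯) (sym (π₁-combine i j)) finA
                               , subst (T ∘ Transducer.final B.𝒯) (sym (π₂-combine i j)) finB) , out) ,
       from acceptsDataWord-product (from PA.acceptsDataWord-project (fibresA , dwA) ,
                                     from PB.acceptsDataWord-project (fibresB , dwB)) ,
       λ c c∈ → [ keysA′ c , keysB′ c ]′ (x∈p∪q⁻ _ _ c∈)

  intersection-correct : ∀ t → ODTAAccepts intersection t ⇔ (ODTAAccepts A t × ODTAAccepts B t)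
  intersection-correct t = mk⇔ accepts⁻ (λ (accA , accB) → accepts⁺ accA accB)

-- Complement

Labels⁴ : Set → Set
Labels⁴ L = L × L × L × L

block : ∀ {L : Set} → Labels⁴ L → ℕ × ℕ → List (L × ℕ)
block (l₁ , l₂ , l₃ , l₄) (v , u) = (l₁ , suc v) ∷ (l₂ , 0) ∷ (l₃ , suc u) ∷ (l₄ , 0) ∷ []

flatten : ∀ {L : Set} → List (Labels⁴ L × (ℕ × ℕ)) → List (L × ℕ)
flatten []              = []
flatten ((ls , p) ∷ G) = block ls p ++ flatten G

flatten-++ : ∀ {L : Set} (G H : List (Labels⁴ L × (ℕ × ℕ))) → flatten (G ++ H) ≡ flatten G ++ flatten H
flatten-++ []              H = refl
flatten-++ ((ls , p) ∷ G) H =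
  trans (cong (block ls p ++_) (flatten-++ G H)) (sym (++-assoc (block ls p) (flatten G) (flatten H)))

labels-flatten : ∀ {L : Set} (G H : List (Labels⁴ L × (ℕ × ℕ))) →
                 map proj₁ G ≡ map proj₁ H → map proj₁ (flatten G) ≡ map proj₁ (flatten H)
labels-flatten []      []      _  = refl
labels-flatten (_ ∷ G) (_ ∷ H) eq with refl ← ∷-injectiveˡ eq =
  cong (λ xs → _ ∷ _ ∷ _ ∷ _ ∷ xs) (labels-flatten G H (∷-injectiveʳ eq))

values-flatten : ∀ {L L′ : Set} (G : List (Labels⁴ L × (ℕ × ℕ))) (H : List (Labels⁴ L′ × (ℕ × ℕ))) →
                 map proj₂ G ≡ map proj₂ H → map proj₂ (flatten G) ≡ map proj₂ (flatten H)
values-flatten []      []      _  = refl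
values-flatten (_ ∷ G) (_ ∷ H) eq with refl ← ∷-injectiveˡ eq =
  cong (λ xs → _ ∷ _ ∷ _ ∷ _ ∷ xs) (values-flatten G H (∷-injectiveʳ eq))

headValue : ∀ {A : Set} → List (A × ℕ) → Maybe ℕ
headValue []      = nothing
headValue (x ∷ _) = just (proj₂ x)

profileRow : ∀ {k} → Maybe ℕ → List (Fin k × ℕ) → List (PLetter k × ℕ)
profileRow l []             = []
profileRow l ((x , d) ∷ xs) = ((x , cmp l d , cmp (just 0) d , cmp (headValue xs) d) , d) ∷ profileRow (just d) xs

profileF-leaves : ∀ {k} l (xs : List (Fin k × ℕ)) → profileF (just 0) l (map leaf xs) ≡ map leaf (profileRow l xs)
profileF-leaves l []           = refl
profileF-leaves l (x ∷ [])     = refl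
profileF-leaves l ((a , d) ∷ y ∷ xs) =
  cong (leaf ((a , cmp l d , cmp (just 0) d , cmp (just (proj₂ y)) d) , d) ∷_) (profileF-leaves (just d) (y ∷ xs))

values-profileRow : ∀ {k} l (xs : List (Fin k × ℕ)) → map proj₂ (profileRow l xs) ≡ map proj₂ xs
values-profileRow l []       = refl
values-profileRow l (x ∷ xs) = cong (proj₂ x ∷_) (values-profileRow (just (proj₂ x)) xs)

module LeafRow {k m : ℕ} (𝒯 : Transducer k m) where

  outputs : ∀ {qs} xs {ts} → Outs 𝒯 qs (map leaf xs) ts → ∃[ zs ] ts ≡ map leaf zs × map proj₂ zs ≡ map proj₂ xs
  outputs []             []                          = [] , refl , refl
  outputs ((L , d) ∷ xs) (node {b = c} _ _ [] ∷ outs) with zs , refl , eq ← outputs xs outs =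
    (c , d) ∷ zs , refl , cong (d ∷_) eq

  rerun : ∀ {qs} xs zs xs′ zs′ → Outs 𝒯 qs (map leaf xs) (map leaf zs) →
          map proj₁ xs′ ≡ map proj₁ xs → map proj₁ zs′ ≡ map proj₁ zs → map proj₂ zs′ ≡ map proj₂ xs′ →
          Outs 𝒯 qs (map leaf xs′) (map leaf zs′)
  rerun [] [] [] [] [] _ _ _ = []
  rerun ((L , d) ∷ xs) ((c , .d) ∷ zs) ((L′ , d′) ∷ xs′) ((c′ , d″) ∷ zs′) (node μ acc [] ∷ outs) eqL eqC eqV
    with refl ← ∷-injectiveˡ eqL | refl ← ∷-injectiveˡ eqC | refl ← ∷-injectiveˡ eqV =
    node μ acc [] ∷ rerun xs zs xs′ zs′ outs (∷-injectiveʳ eqL) (∷-injectiveʳ eqC) (∷-injectiveʳ eqV)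

pattern 𝑎 = zero
pattern 𝑏 = suc zero

abab : Labels⁴ (Fin 2)
abab = 𝑎 , 𝑎 , 𝑏 , 𝑎

children : List (ℕ × ℕ) → List (Fin 2 × ℕ)
children ps = flatten (map (abab ,_) ps)

blocksTree : List (ℕ × ℕ) → DTree 2
blocksTree ps = node (𝑎 , 0) (map leaf (children ps))

Profile-blocksTree : ∀ ps →
  Profile (blocksTree ps) ≡ node ((𝑎 , star , star , star) , 0) (map leaf (profileRow nothing (children ps)))
Profile-blocksTree ps = cong (node _) (profileF-leaves nothing (children ps))

values-abab : ∀ (ps : List (ℕ × ℕ)) → map proj₂ (map (abab ,_) ps) ≡ ps
values-abab []       = refl
values-abab (p ∷ ps) = cong (p ∷_) (values-abab ps)

labels-profileRow-children : ∀ {l} → l ≡ nothing ⊎ l ≡ just 0 → ∀ ps ps′ → length ps ≡ length ps′ →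
  map proj₁ (profileRow l (children ps)) ≡ map proj₁ (profileRow l (children ps′))
labels-profileRow-children l≡ [] [] _ = refl
labels-profileRow-children {l} l≡ ((v , u) ∷ ps) ((v′ , u′) ∷ ps′) eq =
  cong₂ _∷_ (cong (λ r → 𝑎 , r , bot , bot) (leftmost l≡))
    (cong (λ xs → (𝑎 , bot , top , bot) ∷ (𝑏 , bot , bot , bot) ∷ xs)
      (cong₂ _∷_ (cong (λ r → 𝑎 , bot , top , r) (rightmost ps ps′ (suc-injective eq)))
        (labels-profileRow-children (inj₂ refl) ps ps′ (suc-injective eq))))
  where
  leftmost : l ≡ nothing ⊎ l ≡ just 0 → cmp l (suc v) ≡ cmp l (suc v′)
  leftmost (inj₁ refl) = refl
  leftmost (inj₂ refl) = refl

  rightmost : ∀ ps ps′ → length ps ≡ length ps′ → cmp (headValue (children ps)) 0 ≡ cmp (headValue (children ps′)) 0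
  rightmost []      []      _ = refl
  rightmost (_ ∷ _) (_ ∷ _) _ = refl

unflatten : ∀ {L L′ : Set} (G : List (Labels⁴ L × (ℕ × ℕ))) (zs : List (L′ × ℕ)) →
            map proj₂ zs ≡ map proj₂ (flatten G) → ∃[ H ] zs ≡ flatten H × map proj₂ H ≡ map proj₂ G
unflatten [] [] _ = [] , refl , refl
unflatten ((_ , (v , u)) ∷ G) ((c₁ , d₁) ∷ (c₂ , d₂) ∷ (c₃ , d₃) ∷ (c₄ , d₄) ∷ zs) eq
  with refl , eq′ ← ∷⁴-injective eq
  with H , refl , H≡ ← unflatten G zs eq′ =
  ((c₁ , c₂ , c₃ , c₄) , (v , u)) ∷ H , refl , cong ((v , u) ∷_) H≡

withB : ℕ × ℕ → ℕ × ℕ → ℕ × ℕ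
withB (v , _) (_ , u) = v , u

third : ∀ {L : Set} → Labels⁴ L × (ℕ × ℕ) → L
third ((_ , _ , l₃ , _) , _) = l₃

module _ {L : Set} where

  exchangeBlocks : ∀ {G : List (Labels⁴ L × (ℕ × ℕ))} → TwoPicks G → List (Labels⁴ L × (ℕ × ℕ))
  exchangeBlocks (picks pre (ls , p) mid (ls′ , p′) post _) =
    pre ++ (ls , withB p p′) ∷ mid ++ (ls′ , withB p′ p) ∷ post

  flatten-picks : ∀ (pre : List (Labels⁴ L × (ℕ × ℕ))) X mid Y post →
    flatten (pre ++ X ∷ mid ++ Y ∷ post) ≡
    flatten pre ++ block (proj₁ X) (proj₂ X) ++ flatten mid ++ block (proj₁ Y) (proj₂ Y) ++ flatten post
  flatten-picks pre X mid Y post = trans (flatten-++ pre (X ∷ mid ++ Y ∷ post))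
    (cong (λ zs → flatten pre ++ block (proj₁ X) (proj₂ X) ++ zs) (flatten-++ mid (Y ∷ post)))

  labels-exchangeBlocks : ∀ {G} (p : TwoPicks G) → map proj₁ (exchangeBlocks p) ≡ map proj₁ G
  labels-exchangeBlocks (picks pre X mid Y post refl) =
    trans (map-picks proj₁ pre _ mid _ post) (sym (map-picks proj₁ pre X mid Y post))

  length-exchangeBlocks : ∀ {G} (p : TwoPicks G) → length (exchangeBlocks p) ≡ length G
  length-exchangeBlocks {G} p =
    trans (length-≡-map proj₁ (exchangeBlocks p) (labels-exchangeBlocks p)) (length-map proj₁ G)

  flatten-exchangeBlocks : ∀ {G} (p : TwoPicks G) → third (TwoPicks.x p) ≡ third (TwoPicks.y p) →
                           flatten (exchangeBlocks p) ↭ flatten G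
  flatten-exchangeBlocks (picks pre ((l₁ , l₂ , l₃ , l₄) , (v , u)) mid ((k₁ , k₂ , .l₃ , k₄) , (v′ , u′)) post refl)
                         refl = begin
    flatten (pre ++ X′ ∷ mid ++ Y′ ∷ post)
      ≡⟨ flatten-picks pre X′ mid Y′ post ⟩
    flatten pre ++ x₁ ∷ x₂ ∷ (l₃ , suc u′) ∷ x₄ ∷ (flatten mid ++ y₁ ∷ y₂ ∷ (l₃ , suc u) ∷ y₄ ∷ flatten post)
      ≡⟨ reassociate (flatten pre) x₁ x₂ _ x₄ (flatten mid) y₁ y₂ _ (y₄ ∷ flatten post) ⟩
    (flatten pre ++ x₁ ∷ x₂ ∷ []) ++ (l₃ , suc u′) ∷ (x₄ ∷ flatten mid ++ y₁ ∷ y₂ ∷ []) ++ (l₃ , suc u) ∷ y₄ ∷ flatten post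
      ↭⟨ ↭-exchange (flatten pre ++ x₁ ∷ x₂ ∷ []) _ (x₄ ∷ flatten mid ++ y₁ ∷ y₂ ∷ []) _ (y₄ ∷ flatten post) ⟩
    (flatten pre ++ x₁ ∷ x₂ ∷ []) ++ (l₃ , suc u) ∷ (x₄ ∷ flatten mid ++ y₁ ∷ y₂ ∷ []) ++ (l₃ , suc u′) ∷ y₄ ∷ flatten post
      ≡⟨ sym (reassociate (flatten pre) x₁ x₂ _ x₄ (flatten mid) y₁ y₂ _ (y₄ ∷ flatten post)) ⟩
    flatten pre ++ x₁ ∷ x₂ ∷ (l₃ , suc u) ∷ x₄ ∷ (flatten mid ++ y₁ ∷ y₂ ∷ (l₃ , suc u′) ∷ y₄ ∷ flatten post)
      ≡⟨ sym (flatten-picks pre X mid Y post) ⟩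
    flatten (pre ++ X ∷ mid ++ Y ∷ post) ∎
    where
    open PermutationReasoning
    reassociate : ∀ (A : List (L × ℕ)) a₁ a₂ e a₄ M b₁ b₂ e′ R →
      A ++ a₁ ∷ a₂ ∷ e ∷ a₄ ∷ (M ++ b₁ ∷ b₂ ∷ e′ ∷ R) ≡ (A ++ a₁ ∷ a₂ ∷ []) ++ e ∷ (a₄ ∷ M ++ b₁ ∷ b₂ ∷ []) ++ e′ ∷ R
    reassociate A a₁ a₂ e a₄ M b₁ b₂ e′ R = sym (trans (++-assoc A (a₁ ∷ a₂ ∷ []) _)
      (cong (λ xs → A ++ a₁ ∷ a₂ ∷ e ∷ a₄ ∷ xs) (++-assoc M (b₁ ∷ b₂ ∷ []) (e′ ∷ R))))
    X Y X′ Y′ : Labels⁴ L × (ℕ × ℕ)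
    x₁ x₂ x₄ y₁ y₂ y₄ : L × ℕ
    X  = (l₁ , l₂ , l₃ , l₄) , (v , u)
    Y  = (k₁ , k₂ , l₃ , k₄) , (v′ , u′)
    X′ = (l₁ , l₂ , l₃ , l₄) , (v , u′)
    Y′ = (k₁ , k₂ , l₃ , k₄) , (v′ , u)
    x₁ = (l₁ , suc v)
    x₂ = (l₂ , 0)
    x₄ = (l₄ , 0)
    y₁ = (k₁ , suc v′)
    y₂ = (k₂ , 0)
    y₄ = (k₄ , 0)

module _ (B : ODTA 2) where
  open ODTA B

  accepts-exchangeBlocks : ∀ ps → m < length ps → ODTAAccepts B (blocksTree ps) →
             ∃[ H ] map proj₂ H ≡ ps × Σ (TwoPicks H) λ p → ODTAAccepts B (blocksTree (map proj₂ (exchangeBlocks p)))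
  accepts-exchangeBlocks ps m<len (t′ , (q , fin , out) , dw , keys)
    with node {b = c₀} μ₀ acc₀ outs ← subst (λ s → Out 𝒯 q s t′) (Profile-blocksTree ps) out
    with zs , refl , zs-values ← LeafRow.outputs 𝒯 _ outs
    with H , refl , H-values ← unflatten (map (abab ,_) ps) zs (trans zs-values (values-profileRow nothing (children ps)))
    with p , third≡ ← pigeonhole-picks third H
                        (subst (m <_) (sym (length-≡-map proj₂ H (trans H-values (values-abab ps)))) m<len) =
    H , H≡ps , p ,
    t₂ ,
    (q , fin , subst (λ s → Out 𝒯 q s t₂) (sym (Profile-blocksTree ps′))
                 (node μ₀ acc₀ (LeafRow.rerun 𝒯 _ _ _ _ outs labels-row labels-out values-out))) ,
    acceptsDataWord-resp-↭ {t = t₁} {t₂} nodes↭ dw , keysDistinct-resp-↭ {t = t₁} {t₂} nodes↭ keys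
    where
    H≡ps : map proj₂ H ≡ ps
    H≡ps = trans H-values (values-abab ps)

    H′ : List (Labels⁴ (Fin m) × (ℕ × ℕ))
    H′ = exchangeBlocks p
    ps′ : List (ℕ × ℕ)
    ps′ = map proj₂ H′

    length-ps′ : length ps′ ≡ length ps
    length-ps′ = trans (length-map proj₂ H′) (trans (length-exchangeBlocks p) (length-≡-map proj₂ H H≡ps))

    labels-row : map proj₁ (profileRow nothing (children ps′)) ≡ map proj₁ (profileRow nothing (children ps))
    labels-row = labels-profileRow-children (inj₁ refl) ps′ ps length-ps′

    labels-out : map proj₁ (flatten H′) ≡ map proj₁ (flatten H)
    labels-out = labels-flatten H′ H (labels-exchangeBlocks p)

    values-out : map proj₂ (flatten H′) ≡ map proj₂ (profileRow nothing (children ps′))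
    values-out = trans (values-flatten H′ (map (abab ,_) ps′) (sym (values-abab ps′)))
                       (sym (values-profileRow nothing (children ps′)))

    t₁ t₂ : Tree (Fin m × ℕ)
    t₁ = node (c₀ , 0) (map leaf (flatten H))
    t₂ = node (c₀ , 0) (map leaf (flatten H′))

    nodes↭ : nodes t₁ ↭ nodes t₂
    nodes↭ = ↭-prep (c₀ , 0) (subst₂ _↭_ (sym (nodesF-leaves (flatten H))) (sym (nodesF-leaves (flatten H′)))
                                (↭-sym (flatten-exchangeBlocks p third≡)))

matches : ∀ {n} → Maybe (Fin n) → Fin n → Bool
matches x y = does (≡-dec-Maybe _≟_ x (just y))

T-matches : ∀ {n} {x : Maybe (Fin n)} {y} → T (matches x y) → x ≡ just y
T-matches {x = x} {y} t with ≡-dec-Maybe _≟_ x (just y)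
... | yes eq = eq

pattern marked   = zero
pattern unmarked = suc zero

pattern qRoot   = zero
pattern qPlain  = suc zero
pattern qFirst  = suc (suc zero)
pattern qSecond = suc (suc (suc zero))

pattern before       = zero
pattern afterFirst   = suc zero
pattern beforeSecond = suc (suc zero)
pattern after        = suc (suc (suc zero))

rowNext : Fin 4 → Fin 4 → Maybe (Fin 4)
rowNext before       qPlain  = just before
rowNext before       qFirst  = just afterFirst
rowNext afterFirst   qPlain  = just beforeSecond
rowNext beforeSecond qSecond = just after
rowNext after        qPlain  = just after
rowNext _            _       = nothing

rowNFA : NFA (Fin 4)
rowNFA = record
  { nst = 4 ; start = λ s → does (s ≟ before) ; accept = λ s → does (s ≟ after)
  ; step = λ s q s′ → matches (rowNext s q) s′ }

leafNFA : NFA (Fin 4)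
leafNFA = record { nst = 1 ; start = const true ; accept = const true ; step = λ _ _ _ → false }

universalNFA : ∀ {A : Set} → NFA A
universalNFA = record { nst = 1 ; start = const true ; accept = const true ; step = λ _ _ _ → true }

universalNFA-accepts : ∀ {A : Set} (w : List A) → NFAAccepts universalNFA w
universalNFA-accepts w = zero , tt , reach w
  where
  reach : ∀ w → Reach universalNFA zero w
  reach []      = done tt
  reach (_ ∷ w) = next {s' = zero} tt (reach w)

childrenNFA : Fin 4 → PLetter 2 → NFA (Fin 4)
childrenNFA qRoot _ = rowNFA
childrenNFA _     _ = leafNFA

output : Fin 4 → PLetter 2 → Maybe (Fin 2)
output qRoot   _       = just unmarked
output qPlain  _       = just unmarked
output qFirst  _       = just marked
output qSecond (𝑏 , _) = just marked
output _       _       = nothing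

-- The root reads the states of its children as plain* first plain second plain*; the key label
-- `marked` of the first and second child forces distinct values, and the second must be a b.
mismatch : ODTA 2
mismatch = record
  { m  = 2
  ; 𝒯  = record { nQ = 4 ; final = λ q → does (q ≟ qRoot) ; δ = childrenNFA ; μ = λ q L c → matches (output q L) c }
  ; ℳ  = universalNFA
  ; Γ₀ = ⁅ marked ⁆
  }

private
  module M = ODTA mismatch

rowNext-step : ∀ s q {s′} → T (NFA.step rowNFA s q s′) → rowNext s q ≡ just s′
rowNext-step s q {s′} = T-matches {x = rowNext s q} {s′}

output-μ : ∀ q L {c} → T (Transducer.μ M.𝒯 q L c) → output q L ≡ just c
output-μ q L {c} = T-matches {x = output q L} {c}

markedValues : List (Fin 2 × ℕ) → List ℕ
markedValues zs = map proj₂ (filter (λ x → proj₁ x ≟ marked) zs)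

valsOf-marked : ∀ zs → valsOf marked (node (unmarked , 0) (map leaf zs)) ≡ markedValues zs
valsOf-marked zs = cong markedValues (nodesF-leaves zs)

Matched : ℕ × ℕ → Set
Matched (v , u) = v ≡ u

Echoes : List (PLetter 2 × ℕ) → Set
Echoes (y₁ ∷ y₂ ∷ y₃ ∷ ys) = (proj₁ (proj₁ y₃) ≡ 𝑏 → proj₂ y₁ ≡ proj₂ y₃) × Echoes (y₂ ∷ y₃ ∷ ys)
Echoes _                   = ⊤

echoes-tail : ∀ y ys → Echoes (y ∷ ys) → Echoes ys
echoes-tail y []            _            = tt
echoes-tail y (_ ∷ [])      _            = tt
echoes-tail y (_ ∷ _ ∷ _)   (_ , echoes) = echoes

echoes-children : ∀ {l} ps → All Matched ps → Echoes (profileRow l (children ps))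
echoes-children []                []                 = tt
echoes-children (_ ∷ [])          (refl ∷ [])        = (λ _ → refl) , (λ ()) , tt
echoes-children (_ ∷ ps@(_ ∷ _))  (refl ∷ matched)   =
  (λ _ → refl) , (λ ()) , (λ ()) , (λ ()) , echoes-children {just 0} ps matched

row-after : ∀ ys {qs ts} → Reach rowNFA after qs → Outs M.𝒯 qs (map leaf ys) ts →
            ∃[ zs ] ts ≡ map leaf zs × markedValues zs ≡ []
row-after []       (done _)                     []   = [] , refl , refl
row-after (_ ∷ _)  (next {a = qRoot}   () _)    _
row-after (_ ∷ _)  (next {a = qFirst}  () _)    _
row-after (_ ∷ _)  (next {a = qSecond} () _)    _
row-after (y ∷ ys) (next {s' = s′} {a = qPlain} step rch) (node {a = L} {b = c} μ _ [] ∷ outs)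
  with refl ← rowNext-step after qPlain {s′} step | refl ← output-μ qPlain L {c} μ
  with zs , refl , eq ← row-after ys rch outs =
  (unmarked , proj₂ y) ∷ zs , refl , eq

row-beforeSecond : ∀ ys {qs ts} → Reach rowNFA beforeSecond qs → Outs M.𝒯 qs (map leaf ys) ts →
  ∃[ y ] ∃[ ys′ ] ys ≡ y ∷ ys′ × proj₁ (proj₁ y) ≡ 𝑏 × ∃[ zs ] ts ≡ map leaf zs × markedValues zs ≡ proj₂ y ∷ []
row-beforeSecond []      (done ())                  []
row-beforeSecond (_ ∷ _) (next {a = qRoot}  () _)   _
row-beforeSecond (_ ∷ _) (next {a = qPlain} () _)   _
row-beforeSecond (_ ∷ _) (next {a = qFirst} () _)   _
row-beforeSecond (((𝑎 , L) , d) ∷ ys) (next {a = qSecond} step rch) (node () _ [] ∷ outs)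
row-beforeSecond (((𝑏 , L) , d) ∷ ys) (next {s' = s′} {a = qSecond} step rch) (node {b = c} μ _ [] ∷ outs)
  with refl ← rowNext-step beforeSecond qSecond {s′} step | refl ← output-μ qSecond (𝑏 , L) {c} μ
  with zs , refl , eq ← row-after ys rch outs =
  ((𝑏 , L) , d) , ys , refl , refl , (marked , d) ∷ zs , refl , cong (d ∷_) eq

row-afterFirst : ∀ ys {qs ts} → Reach rowNFA afterFirst qs → Outs M.𝒯 qs (map leaf ys) ts →
  ∃[ y₂ ] ∃[ y₃ ] ∃[ ys′ ] ys ≡ y₂ ∷ y₃ ∷ ys′ × proj₁ (proj₁ y₃) ≡ 𝑏 ×
  ∃[ zs ] ts ≡ map leaf zs × markedValues zs ≡ proj₂ y₃ ∷ []
row-afterFirst []      (done ())                   []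
row-afterFirst (_ ∷ _) (next {a = qRoot}   () _)   _
row-afterFirst (_ ∷ _) (next {a = qFirst}  () _)   _
row-afterFirst (_ ∷ _) (next {a = qSecond} () _)   _
row-afterFirst (y ∷ ys) (next {s' = s′} {a = qPlain} step rch) (node {a = L} {b = c} μ _ [] ∷ outs)
  with refl ← rowNext-step afterFirst qPlain {s′} step | refl ← output-μ qPlain L {c} μ
  with y₃ , ys′ , refl , y₃-b , zs , refl , eq ← row-beforeSecond ys rch outs =
  y , y₃ , ys′ , refl , y₃-b , (unmarked , proj₂ y) ∷ zs , refl , eq

row-before : ∀ ys {qs ts} → Reach rowNFA before qs → Outs M.𝒯 qs (map leaf ys) ts → Echoes ys →
             ∃[ zs ] ts ≡ map leaf zs × ∃[ d ] markedValues zs ≡ d ∷ d ∷ []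
row-before []      (done ())                   [] _
row-before (_ ∷ _) (next {a = qRoot}   () _)   _  _
row-before (_ ∷ _) (next {a = qSecond} () _)   _  _
row-before (y ∷ ys) (next {s' = s′} {a = qPlain} step rch) (node {a = L} {b = c} μ _ [] ∷ outs) echoes
  with refl ← rowNext-step before qPlain {s′} step | refl ← output-μ qPlain L {c} μ
  with zs , refl , d , eq ← row-before ys rch outs (echoes-tail y ys echoes) =
  (unmarked , proj₂ y) ∷ zs , refl , d , eq
row-before (y ∷ ys) (next {s' = s′} {a = qFirst} step rch) (node {a = L} {b = c} μ _ [] ∷ outs) echoes
  with refl ← rowNext-step before qFirst {s′} step | refl ← output-μ qFirst L {c} μ
  with y₂ , y₃ , ys′ , refl , y₃-b , zs , refl , eq ← row-afterFirst ys rch outs =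
  (marked , proj₂ y) ∷ zs , refl , proj₂ y , cong (proj₂ y ∷_) (trans eq (cong (_∷ []) (sym (proj₁ echoes y₃-b))))

mismatch-rejects : ∀ ps → All Matched ps → ¬ ODTAAccepts mismatch (blocksTree ps)
mismatch-rejects ps matched (t′ , (q , fin , out) , _ , keys) with q | fin
... | qPlain  | ()
... | qFirst  | ()
... | qSecond | ()
... | qRoot   | _ with subst (λ s → Out M.𝒯 qRoot s t′) (Profile-blocksTree ps) out
...   | node μ (afterFirst   , () , _) _
...   | node μ (beforeSecond , () , _) _
...   | node μ (after        , () , _) _
...   | node {b = c} μ (before , _ , rch) outs
  with zs , refl , d , eq ← row-before _ rch outs (echoes-children ps matched)
     | refl ← output-μ qRoot (𝑎 , star , star , star) {c} μ
  with (d≢d ∷ _) ∷ _ ← subst Unique (trans (valsOf-marked zs) eq) (keys marked (x∈⁅x⁆ marked)) = d≢d refl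

data MismatchAt : List (PLetter 2 × ℕ) → Set where
  here  : ∀ {y₁ y₂ L d ys} → proj₂ y₁ ≢ d → MismatchAt (y₁ ∷ y₂ ∷ ((𝑏 , L) , d) ∷ ys)
  there : ∀ {y ys} → MismatchAt ys → MismatchAt (y ∷ ys)

mismatchAt-children : ∀ {l} pre v u post → v ≢ u → MismatchAt (profileRow l (children (pre ++ (v , u) ∷ post)))
mismatchAt-children []        v u post v≢u = here (v≢u ∘ suc-injective)
mismatchAt-children (_ ∷ pre) v u post v≢u = there (there (there (there (mismatchAt-children pre v u post v≢u))))

leafNFA-accepts-[] : NFAAccepts leafNFA []
leafNFA-accepts-[] = zero , tt , done tt

unmarkedRow : ∀ ys →
  ∃[ qs ] ∃[ zs ] Reach rowNFA after qs × Outs M.𝒯 qs (map leaf ys) (map leaf zs) × markedValues zs ≡ []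
unmarkedRow []       = [] , [] , done tt , [] , refl
unmarkedRow (y ∷ ys) with qs , zs , rch , outs , eq ← unmarkedRow ys =
  qPlain ∷ qs , (unmarked , proj₂ y) ∷ zs , next {s' = after} tt rch , node tt leafNFA-accepts-[] [] ∷ outs , eq

markedRow : ∀ {ys} → MismatchAt ys →
            ∃[ qs ] ∃[ zs ] Reach rowNFA before qs × Outs M.𝒯 qs (map leaf ys) (map leaf zs) × Unique (markedValues zs)
markedRow (here {y₁} {y₂} {L} {d} {ys} d₁≢d) with qs , zs , rch , outs , eq ← unmarkedRow ys =
  qFirst ∷ qPlain ∷ qSecond ∷ qs ,
  (marked , proj₂ y₁) ∷ (unmarked , proj₂ y₂) ∷ (marked , d) ∷ zs ,
  next {s' = afterFirst} tt (next {s' = beforeSecond} tt (next {s' = after} tt rch)) ,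
  node tt leafNFA-accepts-[] [] ∷ node tt leafNFA-accepts-[] [] ∷ node tt leafNFA-accepts-[] [] ∷ outs ,
  subst (λ vs → Unique (proj₂ y₁ ∷ d ∷ vs)) (sym eq) ((d₁≢d ∷ []) ∷ [] ∷ [])
markedRow (there {y} m) with qs , zs , rch , outs , unique ← markedRow m =
  qPlain ∷ qs , (unmarked , proj₂ y) ∷ zs , next {s' = before} tt rch , node tt leafNFA-accepts-[] [] ∷ outs , unique

mismatch-accepts : ∀ pre v u post → v ≢ u → ODTAAccepts mismatch (blocksTree (pre ++ (v , u) ∷ post))
mismatch-accepts pre v u post v≢u
  with qs , zs , rch , outs , unique ← markedRow (mismatchAt-children {nothing} pre v u post v≢u) =
  t′ ,
  (qRoot , tt , subst (λ s → Out M.𝒯 qRoot s t′) (sym (Profile-blocksTree (pre ++ (v , u) ∷ post)))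
                  (node tt (before , tt , rch) outs)) ,
  (proj₁ (dataWord-exists t′) , proj₂ (dataWord-exists t′) , universalNFA-accepts _) ,
  λ a a∈ → subst (λ a → Unique (valsOf a t′)) (sym (x∈⁅y⁆⇒x≡y marked a∈))
                 (subst Unique (sym (valsOf-marked zs)) unique)
  where
  t′ : Tree (Fin 2 × ℕ)
  t′ = node (unmarked , 0) (map leaf zs)

diagonal : ℕ → List (ℕ × ℕ)
diagonal n = map (λ i → i , i) (upTo n)

length-diagonal : ∀ n → length (diagonal n) ≡ n
length-diagonal n = trans (length-map _ (upTo n)) (length-upTo n)

diagonal-matched : ∀ n → All Matched (diagonal n)
diagonal-matched n = All.map⁺ (All.universal (λ _ → refl) (upTo n))

diagonal-unique : ∀ n → Unique (diagonal n)
diagonal-unique n = Unique.map⁺ (cong proj₁) (Unique.upTo⁺ n)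

mismatch-complement-not-ODTA : ¬ (∃ λ (B : ODTA 2) → ∀ t → ODTAAccepts B t ⇔ (¬ ODTAAccepts mismatch t))
mismatch-complement-not-ODTA (B , B⇔)
  with accepts-exchangeBlocks B (diagonal (suc (ODTA.m B))) (subst (ODTA.m B <_) (sym (length-diagonal _)) (n<1+n _))
                  (from (B⇔ _) (mismatch-rejects _ (diagonal-matched (suc (ODTA.m B)))))
... | H , H≡ps , p@(picks pre (_ , (v , u)) mid (_ , (v′ , u′)) post _) , accepts =
  to (B⇔ _) accepts (subst (ODTAAccepts mismatch ∘ blocksTree) (sym (map-picks proj₂ pre _ mid _ post))
                        (mismatch-accepts (map proj₂ pre) v u′ _ v≢u′))
  where
  picked : TwoPicks (map proj₂ H)
  picked = mapPicks proj₂ p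
  matched : All Matched (map proj₂ H)
  matched = subst (All Matched) (sym H≡ps) (diagonal-matched _)

  v≢u′ : v ≢ u′
  v≢u′ refl = picks-distinct (subst Unique (sym H≡ps) (diagonal-unique _)) picked
    (cong₂ _,_ (sym (All.lookup matched (proj₂ (∈-picks picked))))
               (sym (All.lookup matched (proj₁ (∈-picks picked)))))

proposition5p1 :
    (∀ k (A B : ODTA k) → ∃ λ (C : ODTA k) →
        ∀ (t : DTree k) → ODTAAccepts C t ⇔ (ODTAAccepts A t ⊎ ODTAAccepts B t))
    × (∀ k (A B : ODTA k) → ∃ λ (C : ODTA k) →
        ∀ (t : DTree k) → ODTAAccepts C t ⇔ (ODTAAccepts A t × ODTAAccepts B t))
    × (∃ λ k → ∃ λ (A : ODTA k) → ¬ (∃ λ (B : ODTA k) →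
        ∀ (t : DTree k) → ODTAAccepts B t ⇔ (¬ ODTAAccepts A t)))
proposition5p1 =
  (λ k A B → Union.union A B , Union.union-correct A B) ,
  (λ k A B → Intersection.intersection A B , Intersection.intersection-correct A B) ,
  (2 , mismatch , mismatch-complement-not-ODTA)
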